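{- Let $G$ be a simple graph on vertex set $V$ without isolated vertices, with maximum degree $\Delta$, and let $V_i$ be the set of its vertices of degree $i$. For each $j$ and each $i$ define $A_j(j)=\frac{2\mathcal{J}(G)_{jj}}{|V_j|}$ and, for $i\ne j$, $A_j(i)=\frac{\mathcal{J}(G)_{ij}}{|V_j|}$ (for $V_j\neq\emptyset$). For a vertex $v$ and index $i$ let $c_G(v,i)=\lfloor |A_{d(v)}(i)-\mathbf{s}_G(v)_i|\rfloor$, and let $C_G(j)=\sum_{v\in V_j}\sum_{i=1}^{\Delta}c_G(v,i)$. If $C_G(j)\ne 0$, then there exist vertices $u,v\in V_j$ and vertices $w,z$ such that $vw,uz\Rightarrow vz,uw$ is a restricted swap operation transforming $G$ into a graph $G'$ with $C_{G'}(j)<C_G(j)$ and $C_{G'}(\ell)=C_G(\ell)$ for all $\ell\ne j$.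
   Context: $\mathcal{J}(G)_{ij}=|\{xy\in E(G): x\in V_i, y\in V_j\}|$. The degree spectrum $\mathbf{s}_G(v)$ is the vector with $\Delta$ components where $\mathbf{s}_G(v)_i$ is the number of neighbors of $v$ of degree $i$. A swap $ac,bd\Rightarrow bc,ad$ applies to distinct vertices $a,b,c,d$ with $ac,bd\in E$ and $bc,ad\notin E$, replacing $E$ by $(E\setminus\{ac,bd\})\cup\{bc,ad\}$; it is a restricted swap operation (RSO) if $a,b$ have the same degree. Note $A_j(i)$ is the average of $\mathbf{s}_G(v)_i$ over $v\in V_j$ and is invariant under RSOs. -}

module Defs where

open import Data.Bool using (Bool; true; false; if_then_else_; _∧_; _∨_; not)
open import Data.Nat using (ℕ; zero; suc; _⊔_; _<ᵇ_; _≡ᵇ_)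
import Data.Nat as ℕ
open import Data.Fin using (Fin; toℕ)
import Data.Fin as Fin
open import Data.List using (List; allFin; map; foldr; filterᵇ; length; upTo)
open import Data.Nat.ListAction using (sum)
open import Data.Product using (_×_)
open import Data.Integer using (ℤ; +_)
import Data.Integer as ℤ
open import Data.Rational using (ℚ; 0ℚ; _/_; _-_; ∣_∣; floor)
open import Relation.Nullary using (¬_; does)
open import Relation.Binary.PropositionalEquality using (_≡_)

-- A (finite, labelled) graph on vertex set Fin n is given by a Boolean
-- adjacency function; simplicity (symmetry, irreflexivity) is imposed as
-- hypotheses in the theorem.
Adj : ℕ → Set
Adj n = Fin n → Fin n → Bool

Symmetric : ∀ {n} → Adj n → Set
Symmetric {n} A = (x y : Fin n) → A x y ≡ A y x

Irreflexive : ∀ {n} → Adj n → Set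
Irreflexive {n} A = (x : Fin n) → A x x ≡ false

countᵇ : ∀ {a} {X : Set a} → (X → Bool) → List X → ℕ
countᵇ p xs = length (filterᵇ p xs)

sumℤ : List ℤ → ℤ
sumℤ = foldr ℤ._+_ (+ 0)

module _ {n : ℕ} (A : Adj n) where

  deg : Fin n → ℕ
  deg x = countᵇ (λ y → A x y) (allFin n)

  NoIsolated : Set
  NoIsolated = (x : Fin n) → ¬ (deg x ≡ 0)

  Δ : ℕ
  Δ = foldr _⊔_ 0 (map deg (allFin n))

  V : ℕ → List (Fin n)
  V j = filterᵇ (λ x → deg x ≡ᵇ j) (allFin n)

  s : Fin n → ℕ → ℕ
  s v i = countᵇ (λ y → A v y ∧ (deg y ≡ᵇ i)) (allFin n)

  -- J(G)_{ij} = |{ xy ∈ E : x ∈ V_i , y ∈ V_j }|  (unordered edges,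
  -- each edge {x,y} counted once, enumerated as pairs with x < y)
  J : ℕ → ℕ → ℕ
  J i j = sum (map (λ x → countᵇ (λ y → (toℕ x <ᵇ toℕ y) ∧ A x y
                          ∧ (((deg x ≡ᵇ i) ∧ (deg y ≡ᵇ j))
                             ∨ ((deg x ≡ᵇ j) ∧ (deg y ≡ᵇ i))))
                  (allFin n)) (allFin n))

  -- A_j(i) = 2 J_jj / |V_j| if i = j, J_ij / |V_j| otherwise
  -- (only meaningful for V_j ≠ ∅; set to 0 when V_j = ∅, a case never used)
  Avg : ℕ → ℕ → ℚ
  Avg j i with length (V j)
  ... | zero  = 0ℚ
  ... | suc k = (+ (if i ≡ᵇ j then 2 ℕ.* J j j else J i j)) / suc k

  c : Fin n → ℕ → ℤ
  c v i = floor ∣ Avg (deg v) i - ((+ s v i) / 1) ∣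

  C : ℕ → ℤ
  C j = sumℤ (map (λ v → sumℤ (map (λ i → c v i) (map suc (upTo Δ)))) (V j))

samePair : ∀ {n} → Fin n → Fin n → Fin n → Fin n → Bool
samePair x y a b = (does (x Fin.≟ a) ∧ does (y Fin.≟ b))
                 ∨ (does (x Fin.≟ b) ∧ does (y Fin.≟ a))

-- The swap  ac,bd ⇒ bc,ad  is applicable to A: a,b,c,d distinct,
-- ac, bd ∈ E and bc, ad ∉ E.
SwapApplicable : ∀ {n} → Adj n → (a b c d : Fin n) → Set
SwapApplicable A a b c d =
  ¬ (a ≡ b) × ¬ (a ≡ c) × ¬ (a ≡ d) × ¬ (b ≡ c) × ¬ (b ≡ d) × ¬ (c ≡ d)
  × A a c ≡ true × A b d ≡ true × A b c ≡ false × A a d ≡ false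

IsRSO : ∀ {n} → Adj n → (a b c d : Fin n) → Set
IsRSO A a b c d = SwapApplicable A a b c d × deg A a ≡ deg A b

swap : ∀ {n} → Adj n → (a b c d : Fin n) → Adj n
swap A a b c d x y =
  if samePair x y a c ∨ samePair x y b d then false
  else if samePair x y b c ∨ samePair x y a d then true
  else A x y

module Submission where

-- Idea.  Fix j, let q = |V_j| > 0 and p_i = Σ_{x ∈ V_j} s(x,i).  Double counting the
-- edges between V_i and V_j gives A_j(i) = p_i / q, so for x ∈ V_j the cost is
--     c(x,i) = ⌊|p_i/q - s(x,i)|⌋ = |p_i - q·s(x,i)| div q.
-- If C(j) ≠ 0, some x ∈ V_j has |p_i - q·s(x,i)| ≥ q, and averaging over V_j gives
-- v, u ∈ V_j on opposite sides of p_i, one of them by at least q; then s(v,i) ≥ s(u,i) + 2.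
-- This yields a neighbour w of v of degree i outside N(u) ∪ {u}, and (as d(u) = d(v)) a
-- neighbour z of u outside N(v) ∪ {v} with s(v,d(z)) < s(u,d(z)).  The swap vw,uz ⇒ vz,uw
-- keeps all degrees and all A_ℓ(k), and only moves one unit of s(·,i) from v to u and
-- one unit of s(·,d(z)) from u to v; monotonicity and convexity of T ↦ |p - T| div q
-- then show that C(j) drops while every other C(ℓ) is unchanged.

module FiniteSums where

  open import Data.Bool using (Bool; true; false; _∧_; _∨_; T)
  open import Data.Nat
  open import Data.Nat.Properties
  open import Data.Fin using (Fin; zero; suc)
  import Data.Fin as Fin
  open import Data.List using (List; []; _∷_; map; filterᵇ; length; allFin; upTo; applyUpTo; foldr)
  open import Data.List.Membership.Propositional using (_∈_)
  open import Data.List.Relation.Unary.Any using (here; there)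
  open import Data.Nat.ListAction using (sum)
  open import Data.Product using (Σ; _×_; _,_)
  open import Data.Sum using (_⊎_; inj₁; inj₂)
  open import Data.Empty using (⊥-elim)
  open import Relation.Binary.PropositionalEquality
  open import Relation.Nullary using (¬_; yes; no; does)
  open import Function using (_∘_; id)
  open import Data.Nat.Tactic.RingSolver using (solve-∀)

  𝟙 : Bool → ℕ
  𝟙 true = 1
  𝟙 false = 0

  𝟙-∧ : ∀ a b → 𝟙 (a ∧ b) ≡ 𝟙 a * 𝟙 b
  𝟙-∧ true b = sym (+-identityʳ (𝟙 b))
  𝟙-∧ false b = refl

  𝟙-≤1 : ∀ b → 𝟙 b ≤ 1
  𝟙-≤1 true = ≤-refl
  𝟙-≤1 false = z≤n

  𝟙-∨-∧ : ∀ p q r s → 𝟙 ((p ∧ q) ∨ (r ∧ s)) + 𝟙 (p ∧ r) * 𝟙 (q ∧ s) ≡ 𝟙 p * 𝟙 q + 𝟙 r * 𝟙 s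
  𝟙-∨-∧ true true true true = refl
  𝟙-∨-∧ true true true false = refl
  𝟙-∨-∧ true true false s = refl
  𝟙-∨-∧ true false true true = refl
  𝟙-∨-∧ true false true false = refl
  𝟙-∨-∧ true false false s = refl
  𝟙-∨-∧ false q true true = refl
  𝟙-∨-∧ false q true false = refl
  𝟙-∨-∧ false q false s = refl

  𝟙-*-cong : ∀ (b : Bool) {a c : ℕ} → (b ≡ true → a ≡ c) → 𝟙 b * a ≡ 𝟙 b * c
  𝟙-*-cong true h = cong (1 *_) (h refl)
  𝟙-*-cong false h = refl

  𝟙-*-mono : ∀ (b : Bool) {a c : ℕ} → (b ≡ true → a ≤ c) → 𝟙 b * a ≤ 𝟙 b * c
  𝟙-*-mono true h = +-monoˡ-≤ 0 (h refl)
  𝟙-*-mono false h = z≤n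

  𝟙-*-nonzero : ∀ b a → ¬ 𝟙 b * a ≡ 0 → (b ≡ true) × ¬ a ≡ 0
  𝟙-*-nonzero true a h = refl , (λ e → h (trans (+-identityʳ a) e))
  𝟙-*-nonzero false a h = ⊥-elim (h refl)

  ≡ᵇ-true : ∀ {a b} → (a ≡ᵇ b) ≡ true → a ≡ b
  ≡ᵇ-true {a} {b} e = ≡ᵇ⇒≡ a b (subst T (sym e) _)

  ≡ᵇ-refl : ∀ a → (a ≡ᵇ a) ≡ true
  ≡ᵇ-refl zero = refl
  ≡ᵇ-refl (suc a) = ≡ᵇ-refl a

  𝟙-≡ᵇ-refl : ∀ a → 𝟙 (a ≡ᵇ a) ≡ 1
  𝟙-≡ᵇ-refl a = cong 𝟙 (≡ᵇ-refl a)

  𝟙-≡ᵇ-≢ : ∀ {a b} → ¬ a ≡ b → 𝟙 (a ≡ᵇ b) ≡ 0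
  𝟙-≡ᵇ-≢ {a} {b} ne with a ≡ᵇ b in e
  ... | false = refl
  ... | true = ⊥-elim (ne (≡ᵇ-true e))

  ≡ᵇ-comm : ∀ a b → (a ≡ᵇ b) ≡ (b ≡ᵇ a)
  ≡ᵇ-comm zero zero = refl
  ≡ᵇ-comm zero (suc b) = refl
  ≡ᵇ-comm (suc a) zero = refl
  ≡ᵇ-comm (suc a) (suc b) = ≡ᵇ-comm a b

  δ : ∀ {n} → Fin n → Fin n → ℕ
  δ x a = 𝟙 (does (x Fin.≟ a))

  δ-cases : ∀ {n} (y x : Fin n) → (y ≡ x × δ y x ≡ 1) ⊎ (¬ y ≡ x × δ y x ≡ 0)
  δ-cases y x with y Fin.≟ x
  ... | yes p = inj₁ (p , refl)
  ... | no p = inj₂ (p , refl)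

  δ-refl : ∀ {n} (a : Fin n) → δ a a ≡ 1
  δ-refl a with δ-cases a a
  ... | inj₁ (_ , e) = e
  ... | inj₂ (ne , _) = ⊥-elim (ne refl)

  δ-≢ : ∀ {n} {x a : Fin n} → ¬ x ≡ a → δ x a ≡ 0
  δ-≢ {x = x} {a} ne with δ-cases x a
  ... | inj₁ (e , _) = ⊥-elim (ne e)
  ... | inj₂ (_ , e) = e

  module _ {X : Set} where

    ∑ : List X → (X → ℕ) → ℕ
    ∑ [] f = 0
    ∑ (x ∷ xs) f = f x + ∑ xs f

    ∑-cong : ∀ xs {f g : X → ℕ} → (∀ x → f x ≡ g x) → ∑ xs f ≡ ∑ xs g
    ∑-cong [] h = refl
    ∑-cong (x ∷ xs) h = cong₂ _+_ (h x) (∑-cong xs h)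

    ∑-zero : ∀ xs → ∑ xs (λ _ → 0) ≡ 0
    ∑-zero [] = refl
    ∑-zero (x ∷ xs) = ∑-zero xs

    ∑-+ : ∀ xs (f g : X → ℕ) → ∑ xs (λ x → f x + g x) ≡ ∑ xs f + ∑ xs g
    ∑-+ [] f g = refl
    ∑-+ (x ∷ xs) f g = begin
        f x + g x + ∑ xs (λ x → f x + g x) ≡⟨ cong (f x + g x +_) (∑-+ xs f g) ⟩
        f x + g x + (∑ xs f + ∑ xs g)      ≡⟨ +-assoc (f x) (g x) _ ⟩
        f x + (g x + (∑ xs f + ∑ xs g))    ≡⟨ cong (f x +_) (+-comm (g x) _) ⟩
        f x + ((∑ xs f + ∑ xs g) + g x)    ≡⟨ cong (f x +_) (+-assoc (∑ xs f) _ _) ⟩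
        f x + (∑ xs f + (∑ xs g + g x))    ≡⟨ cong (λ t → f x + (∑ xs f + t)) (+-comm (∑ xs g) (g x)) ⟩
        f x + (∑ xs f + (g x + ∑ xs g))    ≡⟨ sym (+-assoc (f x) _ _) ⟩
        f x + ∑ xs f + (g x + ∑ xs g)      ∎
      where open ≡-Reasoning

    ∑-*ˡ : ∀ xs c (f : X → ℕ) → ∑ xs (λ x → c * f x) ≡ c * ∑ xs f
    ∑-*ˡ [] c f = sym (*-zeroʳ c)
    ∑-*ˡ (x ∷ xs) c f = trans (cong (c * f x +_) (∑-*ˡ xs c f)) (sym (*-distribˡ-+ c (f x) _))

    ∑-mono : ∀ xs {f g : X → ℕ} → (∀ x → f x ≤ g x) → ∑ xs f ≤ ∑ xs g
    ∑-mono [] h = z≤n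
    ∑-mono (x ∷ xs) h = +-mono-≤ (h x) (∑-mono xs h)

    ∑-nonzero : ∀ xs (f : X → ℕ) → ¬ ∑ xs f ≡ 0 → Σ X (λ x → x ∈ xs × ¬ f x ≡ 0)
    ∑-nonzero [] f h = ⊥-elim (h refl)
    ∑-nonzero (x ∷ xs) f h with f x in e
    ... | suc _ = x , here refl , (λ p → 0≢1+n (trans (sym p) e))
    ... | zero with ∑-nonzero xs f h
    ... | y , m , nz = y , there m , nz

    ∑-filter : ∀ (P : X → Bool) xs (f : X → ℕ) → ∑ (filterᵇ P xs) f ≡ ∑ xs (λ x → 𝟙 (P x) * f x)
    ∑-filter P [] f = refl
    ∑-filter P (x ∷ xs) f with P x
    ... | true = cong₂ _+_ (sym (+-identityʳ (f x))) (∑-filter P xs f)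
    ... | false = ∑-filter P xs f

    length-filter : ∀ (P : X → Bool) xs → length (filterᵇ P xs) ≡ ∑ xs (λ x → 𝟙 (P x))
    length-filter P [] = refl
    length-filter P (x ∷ xs) with P x
    ... | true = cong suc (length-filter P xs)
    ... | false = length-filter P xs

    sum-map : ∀ xs (f : X → ℕ) → sum (map f xs) ≡ ∑ xs f
    sum-map [] f = refl
    sum-map (x ∷ xs) f = cong (f x +_) (sum-map xs f)

    ∑-δ : ∀ (eq : X → Bool) (a : X) → (∀ x → eq x ≡ true → x ≡ a) → ∀ xs (h : X → ℕ) →
          ∑ xs (λ x → 𝟙 (eq x) * h x) ≡ ∑ xs (λ x → 𝟙 (eq x)) * h a
    ∑-δ eq a sound xs h = trans (∑-cong xs pointwise) (trans (∑-*ˡ xs (h a) (λ x → 𝟙 (eq x))) (*-comm (h a) _))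
      where
        pointwise : ∀ x → 𝟙 (eq x) * h x ≡ h a * 𝟙 (eq x)
        pointwise x with eq x in e
        ... | true = trans (cong (λ y → 1 * h y) (sound x e)) (*-comm 1 (h a))
        ... | false = sym (*-zeroʳ (h a))

  ∑-map : ∀ {X Y : Set} xs (f : Y → X) (h : X → ℕ) → ∑ (map f xs) h ≡ ∑ xs (h ∘ f)
  ∑-map [] f h = refl
  ∑-map (x ∷ xs) f h = cong (h (f x) +_) (∑-map xs f h)

  ∑-comm : ∀ {X Y : Set} (xs : List X) (ys : List Y) (f : X → Y → ℕ) →
           ∑ xs (λ x → ∑ ys (f x)) ≡ ∑ ys (λ y → ∑ xs (λ x → f x y))
  ∑-comm [] ys f = sym (∑-zero ys)
  ∑-comm (x ∷ xs) ys f =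
    trans (cong (∑ ys (f x) +_) (∑-comm xs ys f)) (sym (∑-+ ys (f x) (λ y → ∑ xs (λ x → f x y))))

  maxOf : ∀ {X : Set} → (X → ℕ) → List X → ℕ
  maxOf f xs = foldr _⊔_ 0 (map f xs)

  maxOf-≥ : ∀ {X : Set} (f : X → ℕ) (xs : List X) {x} → x ∈ xs → f x ≤ maxOf f xs
  maxOf-≥ f (y ∷ xs) (here refl) = m≤m⊔n (f y) _
  maxOf-≥ f (y ∷ xs) (there p) = ≤-trans (maxOf-≥ f xs p) (m≤n⊔m (f y) _)

  -- If h' agrees with h except at two points a, b, picked out by weights e₁, e₂ of total
  -- mass one, then the two sums differ exactly by the changes at a and b.
  module _ {X : Set} where

    PointKind : (h h' e₁ e₂ : X → ℕ) (a b x : X) → Set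
    PointKind h h' e₁ e₂ a b x =
        (e₁ x ≡ 1 × e₂ x ≡ 0 × h x ≡ h a × h' x ≡ h' a)
      ⊎ (e₁ x ≡ 0 × e₂ x ≡ 1 × h x ≡ h b × h' x ≡ h' b)
      ⊎ (e₁ x ≡ 0 × e₂ x ≡ 0 × h' x ≡ h x)

    ∑-change-at-two : ∀ xs (h h' e₁ e₂ : X → ℕ) a b → ∑ xs e₁ ≡ 1 → ∑ xs e₂ ≡ 1 →
                      (∀ x → PointKind h h' e₁ e₂ a b x) →
                      ∑ xs h' + (h a + h b) ≡ ∑ xs h + (h' a + h' b)
    ∑-change-at-two xs h h' e₁ e₂ a b m₁ m₂ kind = begin
        ∑ xs h' + (h a + h b)
          ≡⟨ cong₂ (λ s t → ∑ xs h' + (s + t)) (sym (pick e₁ m₁ (h a))) (sym (pick e₂ m₂ (h b))) ⟩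
        ∑ xs h' + (∑ xs (λ x → e₁ x * h a) + ∑ xs (λ x → e₂ x * h b))
          ≡⟨ sym (trans (∑-+ xs _ _) (cong (∑ xs h' +_) (∑-+ xs _ _))) ⟩
        ∑ xs (λ x → h' x + (e₁ x * h a + e₂ x * h b))
          ≡⟨ ∑-cong xs pointwise ⟩
        ∑ xs (λ x → h x + (e₁ x * h' a + e₂ x * h' b))
          ≡⟨ trans (∑-+ xs _ _) (cong (∑ xs h +_) (∑-+ xs _ _)) ⟩
        ∑ xs h + (∑ xs (λ x → e₁ x * h' a) + ∑ xs (λ x → e₂ x * h' b))
          ≡⟨ cong₂ (λ s t → ∑ xs h + (s + t)) (pick e₁ m₁ (h' a)) (pick e₂ m₂ (h' b)) ⟩
        ∑ xs h + (h' a + h' b) ∎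
      where
        open ≡-Reasoning
        pick : ∀ e → ∑ xs e ≡ 1 → ∀ c → ∑ xs (λ x → e x * c) ≡ c
        pick e m c = trans (∑-cong xs (λ x → *-comm (e x) c))
                           (trans (∑-*ˡ xs c e) (trans (cong (c *_) m) (*-identityʳ c)))
        pointwise : ∀ x → h' x + (e₁ x * h a + e₂ x * h b) ≡ h x + (e₁ x * h' a + e₂ x * h' b)
        pointwise x with kind x
        ... | inj₁ (f₁ , f₂ , g , g') rewrite f₁ | f₂ | g | g' = at-a (h' a) (h a) (h b) (h' b)
          where at-a : ∀ x y z w → x + (1 * y + 0 * z) ≡ y + (1 * x + 0 * w)
                at-a = solve-∀
        ... | inj₂ (inj₁ (f₁ , f₂ , g , g')) rewrite f₁ | f₂ | g | g' = at-b (h' b) (h b) (h a) (h' a)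
          where at-b : ∀ x y z w → x + (0 * z + 1 * y) ≡ y + (0 * w + 1 * x)
                at-b = solve-∀
        ... | inj₂ (inj₂ (f₁ , f₂ , g')) rewrite f₁ | f₂ | g' = refl

  indices-apart : ∀ (h h' : ℕ → ℕ) I K → ¬ I ≡ K → (∀ i → ¬ i ≡ I → ¬ i ≡ K → h' i ≡ h i) →
                  ∀ i → PointKind h h' (λ i → 𝟙 (i ≡ᵇ I)) (λ i → 𝟙 (i ≡ᵇ K)) I K i
  indices-apart h h' I K I≢K fixed i with i ≟ I | i ≟ K
  ... | yes refl | yes q = ⊥-elim (I≢K q)
  ... | yes refl | no q = inj₁ (𝟙-≡ᵇ-refl i , 𝟙-≡ᵇ-≢ q , refl , refl)
  ... | no p | yes refl = inj₂ (inj₁ (𝟙-≡ᵇ-≢ p , 𝟙-≡ᵇ-refl i , refl , refl))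
  ... | no p | no q = inj₂ (inj₂ (𝟙-≡ᵇ-≢ p , 𝟙-≡ᵇ-≢ q , fixed i p q))

  cancel-< : ∀ a b X X' → a + X ≡ b + X' → X' < X → a < b
  cancel-< a b X X' e lt = +-cancelʳ-< X' a b (subst (a + X' <_) e (+-monoʳ-< a lt))

  ∑-allFin-suc : ∀ n (h : Fin (suc n) → ℕ) → ∑ (allFin (suc n)) h ≡ h zero + ∑ (allFin n) (h ∘ suc)
  ∑-allFin-suc n h = cong (h zero +_) (trans (cong (λ l → ∑ l h) (sym (map-tabulate id suc))) (∑-map (allFin n) suc h))
    where open import Data.List.Properties using (map-tabulate)

  ∑-allFin-δ : ∀ n (a : Fin n) → ∑ (allFin n) (λ x → 𝟙 (does (x Fin.≟ a))) ≡ 1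
  ∑-allFin-δ (suc n) zero = trans (∑-allFin-suc n (λ x → 𝟙 (does (x Fin.≟ zero)))) (cong suc (∑-zero (allFin n)))
  ∑-allFin-δ (suc n) (suc a) = trans (∑-allFin-suc n (λ x → 𝟙 (does (x Fin.≟ suc a)))) (∑-allFin-δ n a)

  ∑-allFin-const : ∀ n c → ∑ (allFin n) (λ _ → c) ≡ n * c
  ∑-allFin-const zero c = refl
  ∑-allFin-const (suc n) c = trans (∑-allFin-suc n (λ _ → c)) (cong (c +_) (∑-allFin-const n c))

  ∑-δ-Fin : ∀ {n} (a : Fin n) (W : Fin n → ℕ) → ∑ (allFin n) (λ x → δ x a * W x) ≡ W a
  ∑-δ-Fin {n} a W =
    trans (∑-δ (λ y → does (y Fin.≟ a)) a sound (allFin n) W)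
          (trans (cong (_* W a) (∑-allFin-δ n a)) (+-identityʳ (W a)))
    where
      sound : ∀ y → does (y Fin.≟ a) ≡ true → y ≡ a
      sound y e with y Fin.≟ a
      ... | yes p = p

  ∑< : ℕ → (ℕ → ℕ) → ℕ
  ∑< zero φ = 0
  ∑< (suc m) φ = φ 0 + ∑< m (φ ∘ suc)

  ∑-applyUpTo : ∀ {X : Set} m (f : ℕ → X) (h : X → ℕ) → ∑ (applyUpTo f m) h ≡ ∑< m (h ∘ f)
  ∑-applyUpTo zero f h = refl
  ∑-applyUpTo (suc m) f h = cong (h (f 0) +_) (∑-applyUpTo m (f ∘ suc) h)

  ∑<-zero : ∀ m → ∑< m (λ _ → 0) ≡ 0
  ∑<-zero zero = refl
  ∑<-zero (suc m) = ∑<-zero m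

  ∑<-δ : ∀ m a → a < m → ∑< m (λ t → 𝟙 (t ≡ᵇ a)) ≡ 1
  ∑<-δ (suc m) zero h = cong suc (∑<-zero m)
  ∑<-δ (suc m) (suc a) (s≤s h) = ∑<-δ m a h

  ∑-upTo-δ : ∀ m a → a < m → ∑ (upTo m) (λ t → 𝟙 (t ≡ᵇ a)) ≡ 1
  ∑-upTo-δ m a h = trans (∑-applyUpTo m id _) (∑<-δ m a h)

  ∑-range-δ : ∀ Δ a → 1 ≤ a → a ≤ Δ → ∑ (map suc (upTo Δ)) (λ t → 𝟙 (t ≡ᵇ a)) ≡ 1
  ∑-range-δ Δ (suc a) _ (s≤s h) = trans (∑-map (upTo Δ) suc _) (∑-upTo-δ Δ a (s≤s h))

-- The function T ↦ |p - T| div q (q = k + 1): how it changes when T moves by q.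
-- The cost c(x,i) of a vertex x ∈ V_j is this function at T = q·s(x,i).
module DistanceQuotient where

  open import Data.Nat
  open import Data.Nat.Properties
  open import Data.Nat.DivMod
  open import Data.Product using (_×_; _,_)
  open import Data.Sum using (_⊎_; inj₁; inj₂)
  open import Relation.Binary.PropositionalEquality
  open import Relation.Nullary using (¬_; yes; no)
  open import Data.Empty using (⊥-elim)

  distQ : ℕ → ℕ → ℕ → ℕ
  distQ p k T = ∣ p - T ∣ / suc k

  *-suc′ : ∀ q a → q * suc a ≡ q * a + q
  *-suc′ q a = trans (*-suc q a) (+-comm q (q * a))

  module _ (p k : ℕ) where
    private
      q = suc k
      d = distQ p k

    +q/q : ∀ x → (x + q) / q ≡ suc (x / q)
    +q/q x = trans (m/n≡1+[m∸n]/n (m≤n+m q x)) (cong (λ y → suc (y / q)) (m+n∸n≡m x q))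

    distQ-towards : ∀ T → T + q ≤ p → suc (d (T + q)) ≡ d T
    distQ-towards T h = begin
        suc (∣ p - (T + q) ∣ / q) ≡⟨ sym (+q/q ∣ p - (T + q) ∣) ⟩
        (∣ p - (T + q) ∣ + q) / q ≡⟨ cong (_/ q) e ⟩
        ∣ p - T ∣ / q ∎
      where
        open ≡-Reasoning
        e : ∣ p - (T + q) ∣ + q ≡ ∣ p - T ∣
        e = begin
          ∣ p - (T + q) ∣ + q ≡⟨ cong (_+ q) (m≤n⇒∣n-m∣≡n∸m h) ⟩
          (p ∸ (T + q)) + q   ≡⟨ cong (_+ q) (sym (∸-+-assoc p T q)) ⟩
          (p ∸ T ∸ q) + q     ≡⟨ m∸n+n≡m (m+n≤o⇒m≤o∸n q (subst (_≤ p) (+-comm T q) h)) ⟩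
          p ∸ T               ≡⟨ sym (m≤n⇒∣n-m∣≡n∸m (≤-trans (m≤m+n T q) h)) ⟩
          ∣ p - T ∣ ∎

    distQ-away : ∀ T → p ≤ T → d (T + q) ≡ suc (d T)
    distQ-away T h = begin
        ∣ p - (T + q) ∣ / q ≡⟨ cong (_/ q) e ⟩
        (∣ p - T ∣ + q) / q ≡⟨ +q/q ∣ p - T ∣ ⟩
        suc (d T) ∎
      where
        open ≡-Reasoning
        e : ∣ p - (T + q) ∣ ≡ ∣ p - T ∣ + q
        e = begin
          ∣ p - (T + q) ∣ ≡⟨ m≤n⇒∣m-n∣≡n∸m (≤-trans h (m≤m+n T q)) ⟩
          T + q ∸ p       ≡⟨ +-∸-comm q h ⟩
          T ∸ p + q       ≡⟨ cong (_+ q) (sym (m≤n⇒∣m-n∣≡n∸m h)) ⟩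
          ∣ p - T ∣ + q ∎

    distQ-near-below : ∀ T → T ≤ p → p < T + q → d T ≡ 0
    distQ-near-below T h1 h2 =
      trans (cong (_/ q) (m≤n⇒∣n-m∣≡n∸m h1))
            (m<n⇒m/n≡0 (subst (p ∸ T <_) (m+n∸m≡n T q) (∸-monoˡ-< h2 h1)))

    distQ-near-above : ∀ T → p ≤ T → T < p + q → d T ≡ 0
    distQ-near-above T h1 h2 =
      trans (cong (_/ q) (m≤n⇒∣m-n∣≡n∸m h1))
            (m<n⇒m/n≡0 (subst (T ∸ p <_) (m+n∸m≡n p q) (∸-monoˡ-< h2 h1)))

    distQ-nonzero : ∀ T → ¬ d T ≡ 0 → (T + q ≤ p) ⊎ (p + q ≤ T)
    distQ-nonzero T nz with T + q ≤? p
    ... | yes h = inj₁ h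
    ... | no h with p + q ≤? T
    ... | yes h2 = inj₂ h2
    ... | no h2 with T ≤? p
    ... | yes h3 = ⊥-elim (nz (distQ-near-below T h3 (≰⇒> h)))
    ... | no h3 = ⊥-elim (nz (distQ-near-above T (<⇒≤ (≰⇒> h3)) (≰⇒> h2)))

    distQ-step-up : ∀ T → d (T + q) ≤ suc (d T)
    distQ-step-up T with T + q ≤? p
    ... | yes h = ≤-trans (≤-trans (n≤1+n _) (≤-reflexive (distQ-towards T h))) (n≤1+n _)
    ... | no h with p ≤? T
    ... | yes h2 = ≤-reflexive (distQ-away T h2)
    ... | no h2 = subst (_≤ suc (d T)) (sym (distQ-near-above (T + q) (<⇒≤ (≰⇒> h)) (+-monoˡ-< q (≰⇒> h2)))) z≤n

    distQ-step-down : ∀ T → d T ≤ suc (d (T + q))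
    distQ-step-down T with T + q ≤? p
    ... | yes h = ≤-reflexive (sym (distQ-towards T h))
    ... | no h with p ≤? T
    ... | yes h2 = ≤-trans (≤-trans (n≤1+n _) (≤-reflexive (sym (distQ-away T h2)))) (n≤1+n _)
    ... | no h2 = subst (_≤ suc (d (T + q))) (sym (distQ-near-below T (<⇒≤ (≰⇒> h2)) (≰⇒> h))) z≤n

    distQ-up-to : ∀ T → T < p → d (T + q) ≤ d T
    distQ-up-to T h0 with T + q ≤? p
    ... | yes h = ≤-trans (n≤1+n _) (≤-reflexive (distQ-towards T h))
    ... | no h = subst (_≤ d T) (sym (distQ-near-above (T + q) (<⇒≤ (≰⇒> h)) (+-monoˡ-< q h0))) z≤n

    distQ-down-to : ∀ T → p < T + q → d T ≤ d (T + q)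
    distQ-down-to T h0 with p ≤? T
    ... | yes h = ≤-trans (n≤1+n _) (≤-reflexive (sym (distQ-away T h)))
    ... | no h = subst (_≤ d (T + q)) (sym (distQ-near-below T (<⇒≤ (≰⇒> h)) h0)) z≤n

    -- Convexity: moving q from T₁ + q down to T₁ and from T₂ up to T₂ + q, where
    -- T₁ = T₂ or T₁ + q ≤ T₂, does not decrease the total.
    distQ-convex : ∀ T₁ T₂ → (T₁ ≡ T₂) ⊎ (T₁ + q ≤ T₂) → d (T₁ + q) + d T₂ ≤ d T₁ + d (T₂ + q)
    distQ-convex T₁ T₂ h with T₁ + q ≤? p
    ... | yes h₁ = begin
          d (T₁ + q) + d T₂             ≤⟨ +-monoʳ-≤ (d (T₁ + q)) (distQ-step-down T₂) ⟩
          d (T₁ + q) + suc (d (T₂ + q)) ≡⟨ +-suc _ _ ⟩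
          suc (d (T₁ + q)) + d (T₂ + q) ≡⟨ cong (_+ d (T₂ + q)) (distQ-towards T₁ h₁) ⟩
          d T₁ + d (T₂ + q) ∎
      where open ≤-Reasoning
    ... | no h₁ with p ≤? T₂
    ... | yes h₂ = begin
          d (T₁ + q) + d T₂   ≤⟨ +-monoˡ-≤ (d T₂) (distQ-step-up T₁) ⟩
          suc (d T₁) + d T₂   ≡⟨ sym (+-suc _ _) ⟩
          d T₁ + suc (d T₂)   ≡⟨ cong (d T₁ +_) (sym (distQ-away T₂ h₂)) ⟩
          d T₁ + d (T₂ + q) ∎
      where open ≤-Reasoning
    ... | no h₂ with h
    ... | inj₁ refl = ≤-reflexive (+-comm (d (T₁ + q)) (d T₁))
    ... | inj₂ h₃ = ⊥-elim (h₁ (≤-trans h₃ (<⇒≤ (≰⇒> h₂))))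

    Straddle : ℕ → ℕ → Set
    Straddle X Y = ((p + q ≤ X) × (Y < p)) ⊎ ((p < X) × (Y + q ≤ p))

    straddle-gap : ∀ {X Y} → Straddle X Y → Y + q < X
    straddle-gap (inj₁ (h₁ , h₂)) = <-≤-trans (+-monoˡ-< q h₂) h₁
    straddle-gap (inj₂ (h₁ , h₂)) = ≤-<-trans h₂ h₁

    -- Moving q from a straddling upper point T + q to the lower point Y strictly
    -- decreases the total: one of the two moves gains a unit, the other loses none.
    distQ-exchange : ∀ T Y → Straddle (T + q) Y → d T + d (Y + q) < d (T + q) + d Y
    distQ-exchange T Y (inj₁ (h₁ , h₂)) =
      subst (λ t → d T + d (Y + q) < t + d Y) (sym (distQ-away T (+-cancelʳ-≤ q p T h₁)))
            (s≤s (+-monoʳ-≤ (d T) (distQ-up-to Y h₂)))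
    distQ-exchange T Y (inj₂ (h₁ , h₂)) =
      subst (_≤ d (T + q) + d Y) (+-suc (d T) (d (Y + q)))
        (subst (λ t → d T + t ≤ d (T + q) + d Y) (sym (distQ-towards Y h₂))
          (+-monoˡ-≤ (d Y) (distQ-down-to T h₁)))

  module _ (p k : ℕ) where
    private
      q = suc k
      d = distQ p k

    distQ-transfer-strict : ∀ α b → Straddle p k (q * suc α) (q * b) →
                            d (q * α) + d (q * suc b) < d (q * suc α) + d (q * b)
    distQ-transfer-strict α b h =
      subst₂ (λ s t → d (q * α) + d s < d t + d (q * b)) (sym (*-suc′ q b)) (sym (*-suc′ q α))
             (distQ-exchange p k (q * α) (q * b) (subst (λ t → Straddle p k t (q * b)) (*-suc′ q α) h))

    distQ-transfer-weak : ∀ β γ → β ≤ γ → d (q * suc β) + d (q * γ) ≤ d (q * β) + d (q * suc γ)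
    distQ-transfer-weak β γ β≤γ =
      subst₂ (λ s t → d s + d (q * γ) ≤ d (q * β) + d t) (sym (*-suc′ q β)) (sym (*-suc′ q γ))
             (distQ-convex p k (q * β) (q * γ) apart)
      where
        apart : (q * β ≡ q * γ) ⊎ (q * β + q ≤ q * γ)
        apart with m≤n⇒m<n∨m≡n β≤γ
        ... | inj₁ lt = inj₂ (subst (_≤ q * γ) (*-suc′ q β) (*-monoʳ-≤ q lt))
        ... | inj₂ eq = inj₁ (cong (q *_) eq)

module RationalFloor where

  open import Data.Nat using (ℕ; suc)
  import Data.Nat as ℕ
  import Data.Nat.Properties as ℕP
  open import Data.Nat.DivMod using (m*n/o*n≡m/o; /-congˡ; /-congʳ)
  open import Data.Integer using (ℤ; +_)
  import Data.Integer as ℤ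
  import Data.Integer.Properties as ℤP
  open import Data.Integer.GCD using (gcd)
  open import Data.Integer.Tactic.RingSolver using (solve-∀)
  open import Data.Rational using (ℚ; mkℚ; _/_; _-_; ∣_∣; floor; toℚᵘ; ↥_; ↧_)
  import Data.Rational as ℚ
  import Data.Rational.Properties as ℚP
  open import Data.Rational.Unnormalised using (mkℚᵘ; *≡*) renaming (_≃_ to _≃ᵘ_)
  import Data.Rational.Unnormalised.Properties as ℚᵘP
  open import Data.Sum using (inj₁; inj₂)
  open import Relation.Binary.PropositionalEquality
  open DistanceQuotient using (distQ)

  div-cross : ∀ N H d k → N ℕ.* suc k ≡ H ℕ.* suc d → N ℕ./ suc d ≡ H ℕ./ suc k
  div-cross N H d k eq = begin
      N ℕ./ suc d                          ≡⟨ sym (m*n/o*n≡m/o N (suc k) (suc d)) ⟩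
      (N ℕ.* suc k) ℕ./ (suc d ℕ.* suc k)  ≡⟨ /-congˡ eq ⟩
      (H ℕ.* suc d) ℕ./ (suc d ℕ.* suc k)  ≡⟨ /-congʳ {m = H ℕ.* suc d} (ℕP.*-comm (suc d) (suc k)) ⟩
      (H ℕ.* suc d) ℕ./ (suc k ℕ.* suc d)  ≡⟨ m*n/o*n≡m/o H (suc d) (suc k) ⟩
      H ℕ./ suc k ∎
    where open ≡-Reasoning

  floor-abs : ∀ (Z : ℚ) (m : ℤ) (k : ℕ) → toℚᵘ Z ≃ᵘ mkℚᵘ m k → floor ∣ Z ∣ ≡ + (ℤ.∣ m ∣ ℕ./ suc k)
  floor-abs (mkℚ n d _) m k (*≡* eq) =
    trans (ℤP.*-identityˡ (+ (ℤ.∣ n ∣ ℕ./ suc d)))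
          (cong +_ (div-cross ℤ.∣ n ∣ ℤ.∣ m ∣ d k
             (trans (sym (ℤP.abs-* n (+ suc k))) (trans (cong ℤ.∣_∣ eq) (ℤP.abs-* m (+ suc d))))))

  floor-abs-nonneg : ∀ (r : ℚ) → floor ∣ r ∣ ≡ + ℤ.∣ floor ∣ r ∣ ∣
  floor-abs-nonneg (mkℚ m d _) rewrite ℤP.*-identityˡ (+ (ℤ.∣ m ∣ ℕ./ suc d)) = refl

  toℚᵘ-/ : ∀ i d → toℚᵘ (i / suc d) ≃ᵘ mkℚᵘ i d
  toℚᵘ-/ i d = represent (i / suc d) (ℚP.↥-/ i (suc d)) (ℚP.↧-/ i (suc d))
    where
      g = gcd i (+ suc d)
      represent : ∀ (r : ℚ) → ↥ r ℤ.* g ≡ i → ↧ r ℤ.* g ≡ + suc d → toℚᵘ r ≃ᵘ mkℚᵘ i d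
      represent (mkℚ a b _) e₁ e₂ = *≡* (begin
          a ℤ.* + suc d         ≡⟨ cong (a ℤ.*_) (sym e₂) ⟩
          a ℤ.* (+ suc b ℤ.* g) ≡⟨ swap-factors a (+ suc b) g ⟩
          (a ℤ.* g) ℤ.* + suc b ≡⟨ cong (ℤ._* + suc b) e₁ ⟩
          i ℤ.* + suc b ∎)
        where
          open ≡-Reasoning
          swap-factors : ∀ a b c → a ℤ.* (b ℤ.* c) ≡ (a ℤ.* c) ℤ.* b
          swap-factors = solve-∀

  difference-repr : ∀ p k t → toℚᵘ ((+ p / suc k) - (+ t / 1)) ≃ᵘ mkℚᵘ (+ p ℤ.- + (suc k ℕ.* t)) k
  difference-repr p k t =
    ℚᵘP.≃-trans (ℚP.toℚᵘ-homo-+ (+ p / suc k) (ℚ.- (+ t / 1)))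
      (ℚᵘP.≃-trans (ℚᵘP.+-cong (toℚᵘ-/ (+ p) k)
                              (ℚᵘP.≃-trans (ℚP.toℚᵘ-homo‿- (+ t / 1)) (ℚᵘP.-‿cong (toℚᵘ-/ (+ t) 0))))
                  (*≡* cross))
    where
      identity : ∀ P Q T → (P ℤ.* + 1 ℤ.+ (ℤ.- T) ℤ.* Q) ℤ.* Q ≡ (P ℤ.- Q ℤ.* T) ℤ.* (Q ℤ.* + 1)
      identity = solve-∀
      cross : (+ p ℤ.* + 1 ℤ.+ (ℤ.- + t) ℤ.* + suc k) ℤ.* + suc k ≡ (+ p ℤ.- + (suc k ℕ.* t)) ℤ.* + (suc k ℕ.* 1)
      cross rewrite ℤP.pos-* (suc k) t | ℤP.pos-* (suc k) 1 = identity (+ p) (+ suc k) (+ t)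

  ∣+-+∣ : ∀ p T → ℤ.∣ + p ℤ.- + T ∣ ≡ ℕ.∣ p - T ∣
  ∣+-+∣ p T rewrite ℤP.m-n≡m⊖n p T with ℕP.≤-total p T
  ... | inj₁ p≤T = trans (ℤP.∣⊖∣-≤ p≤T) (sym (ℕP.m≤n⇒∣m-n∣≡n∸m p≤T))
  ... | inj₂ T≤p = trans (ℤP.∣m⊖n∣≡∣n⊖m∣ p T) (trans (ℤP.∣⊖∣-≤ T≤p) (sym (ℕP.m≤n⇒∣n-m∣≡n∸m T≤p)))

  floor-distance : ∀ p k t → floor ∣ (+ p / suc k) - (+ t / 1) ∣ ≡ + distQ p k (suc k ℕ.* t)
  floor-distance p k t =
    trans (floor-abs _ _ k (difference-repr p k t)) (cong (λ m → + (m ℕ./ suc k)) (∣+-+∣ p (suc k ℕ.* t)))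

module GraphBasics where

  open import Defs
  open FiniteSums
  open import Data.Bool using (Bool; true; false)
  import Data.Bool as Bool
  open import Data.Bool.Properties using (¬-not; T?)
  open import Data.Nat
  open import Data.Nat.Properties
  open import Data.Fin using (Fin)
  import Data.Fin.Properties as FinP
  open import Data.List using (List; allFin; upTo; length)
  open import Data.List.Membership.Propositional using (_∈_)
  open import Data.List.Membership.Propositional.Properties using (∈-filter⁺; ∈-allFin)
  open import Data.Product using (Σ; _,_)
  open import Data.Sum using (_⊎_; inj₁; inj₂)
  open import Relation.Binary.PropositionalEquality
  open import Relation.Nullary using (yes; no)
  open import Function using (_∘_)

  find : ∀ {n} (P : Fin n → Bool) → Σ (Fin n) (λ y → P y ≡ true) ⊎ (∀ y → P y ≡ false)
  find P with FinP.any? (λ y → P y Bool.≟ true)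
  ... | yes found = inj₁ found
  ... | no none = inj₂ (λ y → ¬-not (λ e → none (y , e)))

  module _ {n} (G : Adj n) where

    deg-as-∑ : ∀ x → deg G x ≡ ∑ (allFin n) (λ y → 𝟙 (G x y))
    deg-as-∑ x = length-filter (G x) (allFin n)

    s-as-∑ : ∀ x i → s G x i ≡ ∑ (allFin n) (λ y → 𝟙 (G x y) * 𝟙 (deg G y ≡ᵇ i))
    s-as-∑ x i = trans (length-filter _ (allFin n)) (∑-cong (allFin n) (λ y → 𝟙-∧ (G x y) _))

    V-length : ∀ j → length (V G j) ≡ ∑ (allFin n) (λ x → 𝟙 (deg G x ≡ᵇ j))
    V-length j = length-filter (λ x → deg G x ≡ᵇ j) (allFin n)

    V-member : ∀ {x j} → deg G x ≡ j → x ∈ V G j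
    V-member {x} {j} dx = ∈-filter⁺ (T? ∘ (λ y → deg G y ≡ᵇ j)) (∈-allFin x) (≡⇒≡ᵇ (deg G x) j dx)

    deg≤n : ∀ x → deg G x ≤ n
    deg≤n x = begin
        deg G x                         ≡⟨ deg-as-∑ x ⟩
        ∑ (allFin n) (λ y → 𝟙 (G x y)) ≤⟨ ∑-mono (allFin n) (λ y → 𝟙-≤1 (G x y)) ⟩
        ∑ (allFin n) (λ _ → 1)          ≡⟨ trans (∑-allFin-const n 1) (*-identityʳ n) ⟩
        n ∎
      where open ≤-Reasoning

    deg≤Δ : ∀ x → deg G x ≤ Δ G
    deg≤Δ x = maxOf-≥ (deg G) (allFin n) (∈-allFin x)

    spectrum-sum : ∀ x → ∑ (upTo (suc n)) (s G x) ≡ deg G x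
    spectrum-sum x = begin
        ∑ U (s G x)                                           ≡⟨ ∑-cong U (s-as-∑ x) ⟩
        ∑ U (λ k → ∑ L (λ y → 𝟙 (G x y) * 𝟙 (deg G y ≡ᵇ k))) ≡⟨ ∑-comm U L _ ⟩
        ∑ L (λ y → ∑ U (λ k → 𝟙 (G x y) * 𝟙 (deg G y ≡ᵇ k))) ≡⟨ ∑-cong L (λ y → ∑-*ˡ U (𝟙 (G x y)) _) ⟩
        ∑ L (λ y → 𝟙 (G x y) * ∑ U (λ k → 𝟙 (deg G y ≡ᵇ k))) ≡⟨ ∑-cong L (λ y → cong (𝟙 (G x y) *_) (one y)) ⟩
        ∑ L (λ y → 𝟙 (G x y) * 1)                             ≡⟨ ∑-cong L (λ y → *-identityʳ _) ⟩
        ∑ L (λ y → 𝟙 (G x y))                                 ≡⟨ sym (deg-as-∑ x) ⟩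
        deg G x ∎
      where
        open ≡-Reasoning
        U = upTo (suc n)
        L = allFin n
        one : ∀ y → ∑ U (λ k → 𝟙 (deg G y ≡ᵇ k)) ≡ 1
        one y = trans (∑-cong U (λ k → cong 𝟙 (≡ᵇ-comm (deg G y) k))) (∑-upTo-δ (suc n) (deg G y) (s≤s (deg≤n y)))

module DoubleCounting where

  open import Defs
  open FiniteSums
  open GraphBasics using (s-as-∑)
  open import Data.Bool using (Bool; true; false; _∧_; _∨_; if_then_else_; T)
  open import Data.Nat
  open import Data.Nat.Properties
  open import Data.Nat.Tactic.RingSolver using (solve-∀)
  open import Data.Fin using (Fin; toℕ)
  import Data.Fin.Properties as FinP
  open import Data.List using (allFin)
  open import Data.Empty using (⊥-elim)
  open import Relation.Binary using (tri<; tri≈; tri>)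
  open import Relation.Binary.PropositionalEquality hiding (J)
  open import Relation.Nullary using (¬_)

  spectrumMass : ∀ {n} → Adj n → ℕ → ℕ → ℕ
  spectrumMass {n} G j i = ∑ (allFin n) (λ x → 𝟙 (deg G x ≡ᵇ j) * s G x i)

  avgNumerator : ∀ {n} → Adj n → ℕ → ℕ → ℕ
  avgNumerator G j i = if i ≡ᵇ j then 2 * J G j j else J G i j

  module _ {n} (A : Adj n) (symA : Symmetric A) (irr : Irreflexive A) where
    private
      L = allFin n
      d = deg A

    lt : Fin n → Fin n → ℕ
    lt x y = 𝟙 (toℕ x <ᵇ toℕ y)

    private
      Tb : ∀ {b} → T b → b ≡ true
      Tb {true} _ = refl
      ¬Tb : ∀ {b} → ¬ T b → b ≡ false
      ¬Tb {true} h = ⊥-elim (h _)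
      ¬Tb {false} _ = refl

    one-orientation : ∀ x y → (lt x y + lt y x) * 𝟙 (A x y) ≡ 𝟙 (A x y)
    one-orientation x y with <-cmp (toℕ x) (toℕ y)
    ... | tri< a _ c rewrite Tb (<⇒<ᵇ a) | ¬Tb (λ h → c (<ᵇ⇒< _ _ h)) = +-identityʳ _
    ... | tri≈ _ b _ rewrite FinP.toℕ-injective b | irr y = *-zeroʳ (lt y y + lt y y)
    ... | tri> a _ c rewrite ¬Tb (λ h → a (<ᵇ⇒< _ _ h)) | Tb (<⇒<ᵇ c) = +-identityʳ _

    module _ (j i : ℕ) where
      private
        P : Fin n → Fin n → ℕ
        P x y = 𝟙 (d x ≡ᵇ j) * 𝟙 (d y ≡ᵇ i)
        Q : Fin n → Fin n → Bool
        Q x y = ((d x ≡ᵇ i) ∧ (d y ≡ᵇ j)) ∨ ((d x ≡ᵇ j) ∧ (d y ≡ᵇ i))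
        -- edges inside one class are seen twice in p_i
        mult : ℕ
        mult = if i ≡ᵇ j then 2 else 1

      J-as-∑ : J A i j ≡ ∑ L (λ x → ∑ L (λ y → lt x y * (𝟙 (A x y) * 𝟙 (Q x y))))
      J-as-∑ = trans (sum-map L _) (∑-cong L (λ x → trans (length-filter _ L)
                 (∑-cong L (λ y → trans (𝟙-∧ (toℕ x <ᵇ toℕ y) _) (cong (lt x y *_) (𝟙-∧ (A x y) _))))))

      mult-Q : ∀ x y → mult * 𝟙 (Q x y) ≡ P x y + P y x
      mult-Q x y with i ≡ᵇ j in e
      ... | false = trans (+-identityʳ _) (trans (sym (+-identityʳ _)) (trans (cong (𝟙 (Q x y) +_) (sym both))
                      (trans (𝟙-∨-∧ (d x ≡ᵇ i) (d y ≡ᵇ j) (d x ≡ᵇ j) (d y ≡ᵇ i))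
                             (reorder (𝟙 (d x ≡ᵇ i)) (𝟙 (d y ≡ᵇ j)) (𝟙 (d x ≡ᵇ j)) (𝟙 (d y ≡ᵇ i))))))
        where
          reorder : ∀ a b c e → a * b + c * e ≡ c * e + b * a
          reorder = solve-∀
          both : 𝟙 ((d x ≡ᵇ i) ∧ (d x ≡ᵇ j)) * 𝟙 ((d y ≡ᵇ j) ∧ (d y ≡ᵇ i)) ≡ 0
          both with d x ≡ᵇ i in e₁ | d x ≡ᵇ j in e₂
          ... | true | true = ⊥-elim (subst T e (≡⇒≡ᵇ i j (trans (sym (≡ᵇ-true {d x} e₁)) (≡ᵇ-true {d x} e₂))))
          ... | true | false = refl
          ... | false | _ = refl
      ... | true with ≡ᵇ-true {i} {j} e
      ... | refl = twice (d x ≡ᵇ i) (d y ≡ᵇ i)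
        where
          twice : ∀ a b → 2 * 𝟙 ((a ∧ b) ∨ (a ∧ b)) ≡ 𝟙 a * 𝟙 b + 𝟙 b * 𝟙 a
          twice true true = refl
          twice true false = refl
          twice false true = refl
          twice false false = refl

      numerator-mult : avgNumerator A j i ≡ mult * J A i j
      numerator-mult with i ≡ᵇ j in e
      ... | false = sym (+-identityʳ _)
      ... | true rewrite ≡ᵇ-true {i} {j} e = refl

      ordered-count : mult * J A i j ≡ ∑ L (λ x → ∑ L (λ y → (lt x y + lt y x) * (𝟙 (A x y) * P x y)))
      ordered-count = begin
          mult * J A i j
            ≡⟨ cong (mult *_) J-as-∑ ⟩
          mult * ∑ L (λ x → ∑ L (λ y → lt x y * (𝟙 (A x y) * 𝟙 (Q x y))))
            ≡⟨ sym (trans (∑-cong L (λ x → ∑-*ˡ L mult _)) (∑-*ˡ L mult _)) ⟩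
          ∑ L (λ x → ∑ L (λ y → mult * (lt x y * (𝟙 (A x y) * 𝟙 (Q x y)))))
            ≡⟨ ∑-cong L (λ x → ∑-cong L (λ y → trans (r₁ mult (lt x y) (𝟙 (A x y)) (𝟙 (Q x y)))
                                                     (cong (λ t → lt x y * (𝟙 (A x y) * t)) (mult-Q x y)))) ⟩
          ∑ L (λ x → ∑ L (λ y → lt x y * (𝟙 (A x y) * (P x y + P y x))))
            ≡⟨ ∑-cong L (λ x → trans (∑-cong L (λ y → r₂ (lt x y) (𝟙 (A x y)) (P x y) (P y x))) (∑-+ L _ _)) ⟩
          ∑ L (λ x → ∑ L (λ y → lt x y * (𝟙 (A x y) * P x y)) + ∑ L (λ y → lt x y * (𝟙 (A x y) * P y x)))
            ≡⟨ ∑-+ L _ _ ⟩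
          ∑ L (λ x → ∑ L (λ y → lt x y * (𝟙 (A x y) * P x y))) + ∑ L (λ x → ∑ L (λ y → lt x y * (𝟙 (A x y) * P y x)))
            ≡⟨ cong (∑ L (λ x → ∑ L (λ y → lt x y * (𝟙 (A x y) * P x y))) +_)
                    (trans (∑-comm L L _) (∑-cong L (λ x → ∑-cong L (λ y → cong (λ t → lt y x * (𝟙 t * P x y)) (symA y x))))) ⟩
          ∑ L (λ x → ∑ L (λ y → lt x y * (𝟙 (A x y) * P x y))) + ∑ L (λ x → ∑ L (λ y → lt y x * (𝟙 (A x y) * P x y)))
            ≡⟨ sym (trans (∑-cong L (λ x → trans (∑-cong L (λ y → *-distribʳ-+ _ (lt x y) (lt y x))) (∑-+ L _ _))) (∑-+ L _ _)) ⟩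
          ∑ L (λ x → ∑ L (λ y → (lt x y + lt y x) * (𝟙 (A x y) * P x y))) ∎
        where
          open ≡-Reasoning
          r₁ : ∀ c a b q → c * (a * (b * q)) ≡ a * (b * (c * q))
          r₁ = solve-∀
          r₂ : ∀ a b p q → a * (b * (p + q)) ≡ a * (b * p) + a * (b * q)
          r₂ = solve-∀

      double-count : avgNumerator A j i ≡ spectrumMass A j i
      double-count = begin
          avgNumerator A j i
            ≡⟨ trans numerator-mult ordered-count ⟩
          ∑ L (λ x → ∑ L (λ y → (lt x y + lt y x) * (𝟙 (A x y) * P x y)))
            ≡⟨ ∑-cong L (λ x → ∑-cong L (λ y → trans (sym (*-assoc (lt x y + lt y x) (𝟙 (A x y)) (P x y)))
                                                     (cong (_* P x y) (one-orientation x y)))) ⟩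
          ∑ L (λ x → ∑ L (λ y → 𝟙 (A x y) * P x y))
            ≡⟨ ∑-cong L (λ x → trans (∑-cong L (λ y → r (𝟙 (A x y)) (𝟙 (d x ≡ᵇ j)) (𝟙 (d y ≡ᵇ i)))) (∑-*ˡ L (𝟙 (d x ≡ᵇ j)) _)) ⟩
          ∑ L (λ x → 𝟙 (d x ≡ᵇ j) * ∑ L (λ y → 𝟙 (A x y) * 𝟙 (d y ≡ᵇ i)))
            ≡⟨ ∑-cong L (λ x → cong (𝟙 (d x ≡ᵇ j) *_) (sym (s-as-∑ A x i))) ⟩
          spectrumMass A j i ∎
        where
          open ≡-Reasoning
          r : ∀ a b c → a * (b * c) ≡ b * (a * c)
          r = solve-∀

module CostFormula where

  open import Defs
  open FiniteSums
  open DistanceQuotient using (distQ)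
  open RationalFloor using (floor-distance; floor-abs-nonneg)
  open DoubleCounting using (spectrumMass; avgNumerator; double-count)
  open import Data.Nat using (ℕ; zero; suc; _*_; _≡ᵇ_)
  open import Data.Fin using (Fin)
  open import Data.List using (List; []; _∷_; map; length; allFin; upTo)
  open import Data.Integer using (ℤ; +_)
  import Data.Integer as ℤ
  import Data.Integer.Properties as ℤP
  open import Data.Rational using (ℚ; 0ℚ; _/_; _-_; ∣_∣; floor)
  open import Relation.Binary.PropositionalEquality hiding (J)

  -- A fraction N / l, with the convention 0 for l = 0 used in the definition of Avg
  fraction : ℕ → ℕ → ℚ
  fraction zero N = 0ℚ
  fraction (suc k) N = (+ N) / suc k

  module _ {n} (G : Adj n) where

    Avg-as-fraction : ∀ j i → Avg G j i ≡ fraction (length (V G j)) (avgNumerator G j i)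
    Avg-as-fraction j i with length (V G j)
    ... | zero = refl
    ... | suc k = refl

    cN : Fin n → ℕ → ℕ
    cN x i = ℤ.∣ c G x i ∣

    c-nonneg : ∀ x i → c G x i ≡ + cN x i
    c-nonneg x i = floor-abs-nonneg (Avg G (deg G x) i - ((+ s G x i) / 1))

    range : List ℕ
    range = map suc (upTo (Δ G))

    vertexCost : Fin n → ℕ
    vertexCost x = ∑ range (cN x)

    classCost : ℕ → ℕ
    classCost j = ∑ (V G j) vertexCost

    C-as-classCost : ∀ j → C G j ≡ + classCost j
    C-as-classCost j = sumℤ-pos (V G j) (λ x → sumℤ-pos range (c-nonneg x))
      where
        sumℤ-pos : ∀ {X : Set} (xs : List X) {f : X → ℤ} {h : X → ℕ} → (∀ x → f x ≡ + h x) →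
                   sumℤ (map f xs) ≡ + ∑ xs h
        sumℤ-pos [] e = refl
        sumℤ-pos (x ∷ xs) {h = h} e = trans (cong₂ ℤ._+_ (e x) (sumℤ-pos xs e)) (sym (ℤP.pos-+ (h x) _))

    classCost-as-∑ : ∀ j → classCost j ≡ ∑ (allFin n) (λ x → 𝟙 (deg G x ≡ᵇ j) * vertexCost x)
    classCost-as-∑ j = ∑-filter (λ x → deg G x ≡ᵇ j) (allFin n) vertexCost

    module _ (symG : Symmetric G) (irrG : Irreflexive G) where

      Avg-as-mass : ∀ j i → Avg G j i ≡ fraction (length (V G j)) (spectrumMass G j i)
      Avg-as-mass j i = trans (Avg-as-fraction j i) (cong (fraction (length (V G j))) (double-count G symG irrG j i))

      cost-formula : ∀ x i j k → deg G x ≡ j → length (V G j) ≡ suc k →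
                     cN x i ≡ distQ (spectrumMass G j i) k (suc k * s G x i)
      cost-formula x i j k dx len = cong ℤ.∣_∣ (begin
          floor ∣ Avg G (deg G x) i - ((+ s G x i) / 1) ∣
            ≡⟨ cong (λ a → floor ∣ a - ((+ s G x i) / 1) ∣)
                    (trans (cong (λ d → Avg G d i) dx) (trans (Avg-as-mass j i) (cong (λ l → fraction l (spectrumMass G j i)) len))) ⟩
          floor ∣ ((+ spectrumMass G j i) / suc k) - ((+ s G x i) / 1) ∣
            ≡⟨ floor-distance (spectrumMass G j i) k (s G x i) ⟩
          + distQ (spectrumMass G j i) k (suc k * s G x i) ∎)
        where open ≡-Reasoning

module SwapEdges where

  open import Defs
  open FiniteSums
  open GraphBasics using (deg-as-∑; s-as-∑)
  open import Data.Bool using (Bool; true; false; _∧_; _∨_; if_then_else_)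
  open import Data.Bool.Properties using (∨-comm; ∧-comm)
  open import Data.Nat
  open import Data.Nat.Properties
  open import Data.Nat.Tactic.RingSolver using (solve-∀)
  open import Data.Fin using (Fin)
  import Data.Fin as Fin
  open import Data.List using (allFin)
  open import Data.Product using (_×_; _,_; proj₁; proj₂)
  open import Data.Sum using (_⊎_; inj₁; inj₂)
  open import Data.Empty using (⊥; ⊥-elim)
  open import Relation.Binary.PropositionalEquality
  open import Relation.Nullary using (¬_; yes; no; does)

  private
    false≢true : false ≡ true → ⊥
    false≢true ()

    refute : {P Q : Set} → (P → ⊥) ⊎ (Q → ⊥) → P → Q → ⊥
    refute (inj₁ f) p _ = f p
    refute (inj₂ g) _ q = g q

  samePair-sound : ∀ {n} (x y a b : Fin n) → samePair x y a b ≡ true → (x ≡ a × y ≡ b) ⊎ (x ≡ b × y ≡ a)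
  samePair-sound x y a b e with x Fin.≟ a | y Fin.≟ b | x Fin.≟ b | y Fin.≟ a
  ... | yes p | yes q | _     | _     = inj₁ (p , q)
  ... | yes _ | no _  | yes p | yes q = inj₂ (p , q)
  ... | no _  | _     | yes p | yes q = inj₂ (p , q)
  ... | yes _ | no _  | yes _ | no _  = ⊥-elim (false≢true e)
  ... | yes _ | no _  | no _  | _     = ⊥-elim (false≢true e)
  ... | no _  | _     | yes _ | no _  = ⊥-elim (false≢true e)
  ... | no _  | _     | no _  | _     = ⊥-elim (false≢true e)

  samePair-unique : ∀ {n} {x y a b c d : Fin n} → samePair x y a b ≡ true → samePair x y c d ≡ true →
                    (a ≡ c × b ≡ d) ⊎ (a ≡ d × b ≡ c)
  samePair-unique {x = x} {y} {a} {b} {c} {d} e₁ e₂ with samePair-sound x y a b e₁ | samePair-sound x y c d e₂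
  ... | inj₁ (refl , refl) | inj₁ (refl , refl) = inj₁ (refl , refl)
  ... | inj₁ (refl , refl) | inj₂ (refl , refl) = inj₂ (refl , refl)
  ... | inj₂ (refl , refl) | inj₁ (refl , refl) = inj₂ (refl , refl)
  ... | inj₂ (refl , refl) | inj₂ (refl , refl) = inj₁ (refl , refl)

  samePair-comm : ∀ {n} (x y a b : Fin n) → samePair x y a b ≡ samePair y x a b
  samePair-comm x y a b =
    trans (∨-comm (does (x Fin.≟ a) ∧ does (y Fin.≟ b)) (does (x Fin.≟ b) ∧ does (y Fin.≟ a)))
          (cong₂ _∨_ (∧-comm (does (x Fin.≟ b)) (does (y Fin.≟ a))) (∧-comm (does (x Fin.≟ a)) (does (y Fin.≟ b))))

  samePair-diag : ∀ {n} (x a b : Fin n) → ¬ a ≡ b → samePair x x a b ≡ false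
  samePair-diag x a b ne with samePair x x a b in e
  ... | false = refl
  ... | true with samePair-sound x x a b e
  ... | inj₁ (p , q) = ⊥-elim (ne (trans (sym p) q))
  ... | inj₂ (p , q) = ⊥-elim (ne (trans (sym q) p))

  𝟙-samePair : ∀ {n} (x y a b : Fin n) → ¬ a ≡ b → 𝟙 (samePair x y a b) ≡ δ x a * δ y b + δ x b * δ y a
  𝟙-samePair x y a b ne =
    trans (sym (+-identityʳ _))
      (trans (cong (𝟙 (samePair x y a b) +_) (sym (cong (_* 𝟙 (does (y Fin.≟ b) ∧ does (y Fin.≟ a))) x-not-both)))
             (𝟙-∨-∧ (does (x Fin.≟ a)) (does (y Fin.≟ b)) (does (x Fin.≟ b)) (does (y Fin.≟ a))))
    where
      x-not-both : 𝟙 (does (x Fin.≟ a) ∧ does (x Fin.≟ b)) ≡ 0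
      x-not-both with x Fin.≟ a | x Fin.≟ b
      ... | yes p | yes q = ⊥-elim (ne (trans (sym p) q))
      ... | yes _ | no _ = refl
      ... | no _ | _ = refl

  ∑-samePair : ∀ {n} (x a b : Fin n) → ¬ a ≡ b → (W : Fin n → ℕ) →
               ∑ (allFin n) (λ y → 𝟙 (samePair x y a b) * W y) ≡ δ x a * W b + δ x b * W a
  ∑-samePair {n} x a b ne W = begin
      ∑ L (λ y → 𝟙 (samePair x y a b) * W y)
        ≡⟨ ∑-cong L (λ y → trans (cong (_* W y) (𝟙-samePair x y a b ne)) (expand (δ x a) (δ y b) (δ x b) (δ y a) (W y))) ⟩
      ∑ L (λ y → δ x a * (δ y b * W y) + δ x b * (δ y a * W y))
        ≡⟨ trans (∑-+ L _ _) (cong₂ _+_ (∑-*ˡ L (δ x a) _) (∑-*ˡ L (δ x b) _)) ⟩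
      δ x a * ∑ L (λ y → δ y b * W y) + δ x b * ∑ L (λ y → δ y a * W y)
        ≡⟨ cong₂ (λ s t → δ x a * s + δ x b * t) (∑-δ-Fin b W) (∑-δ-Fin a W) ⟩
      δ x a * W b + δ x b * W a ∎
    where
      open ≡-Reasoning
      L = allFin n
      expand : ∀ p q r s w → (p * q + r * s) * w ≡ p * (q * w) + r * (s * w)
      expand = solve-∀

  module Swapped {n} (A : Adj n) (symA : Symmetric A) (irr : Irreflexive A) (v u w z : Fin n)
                 (R : IsRSO A v u w z) where

    vu : ¬ v ≡ u
    vu = let (h , _) = proj₁ R in h
    vw : ¬ v ≡ w
    vw = let (_ , h , _) = proj₁ R in h
    vz : ¬ v ≡ z
    vz = let (_ , _ , h , _) = proj₁ R in h
    uw : ¬ u ≡ w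
    uw = let (_ , _ , _ , h , _) = proj₁ R in h
    uz : ¬ u ≡ z
    uz = let (_ , _ , _ , _ , h , _) = proj₁ R in h
    wz : ¬ w ≡ z
    wz = let (_ , _ , _ , _ , _ , h , _) = proj₁ R in h
    Avw : A v w ≡ true
    Avw = let (_ , _ , _ , _ , _ , _ , h , _) = proj₁ R in h
    Auz : A u z ≡ true
    Auz = let (_ , _ , _ , _ , _ , _ , _ , h , _) = proj₁ R in h
    Auw : A u w ≡ false
    Auw = let (_ , _ , _ , _ , _ , _ , _ , _ , h , _) = proj₁ R in h
    Avz : A v z ≡ false
    Avz = let (_ , _ , _ , _ , _ , _ , _ , _ , _ , h) = proj₁ R in h
    dvu : deg A v ≡ deg A u
    dvu = proj₂ R

    A' : Adj n
    A' = swap A v u w z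

    private
      L = allFin n

      edge : ∀ x y {a b : Fin n} {t} → samePair x y a b ≡ true → A a b ≡ t → A x y ≡ t
      edge x y {a} {b} e h with samePair-sound x y a b e
      ... | inj₁ (refl , refl) = h
      ... | inj₂ (refl , refl) = trans (symA x y) h

      apart : ∀ x y {a b c d : Fin n} → (a ≡ c → ⊥) ⊎ (b ≡ d → ⊥) → (a ≡ d → ⊥) ⊎ (b ≡ c → ⊥) →
              samePair x y a b ≡ true → samePair x y c d ≡ true → ⊥
      apart x y h₁ h₂ e₁ e₂ with samePair-unique {x = x} {y} e₁ e₂
      ... | inj₁ (p , q) = refute h₁ p q
      ... | inj₂ (p , q) = refute h₂ p q

    edge-balance : ∀ x y → 𝟙 (A' x y) + 𝟙 (samePair x y v w) + 𝟙 (samePair x y u z)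
                           ≡ 𝟙 (A x y) + 𝟙 (samePair x y u w) + 𝟙 (samePair x y v z)
    edge-balance x y with samePair x y v w in e₁ | samePair x y u z in e₂ | samePair x y u w in e₃ | samePair x y v z in e₄
    ... | true | true | _ | _ = ⊥-elim (apart x y (inj₁ vu) (inj₁ vz) e₁ e₂)
    ... | true | false | true | _ = ⊥-elim (apart x y (inj₁ vu) (inj₁ vw) e₁ e₃)
    ... | true | false | false | true = ⊥-elim (apart x y (inj₂ wz) (inj₁ vz) e₁ e₄)
    ... | true | false | false | false = sym (cong (λ b → 𝟙 b + 0 + 0) (edge x y e₁ Avw))
    ... | false | true | true | _ = ⊥-elim (apart x y (inj₂ (λ e → wz (sym e))) (inj₁ uw) e₂ e₃)
    ... | false | true | false | true = ⊥-elim (apart x y (inj₁ (λ e → vu (sym e))) (inj₁ uz) e₂ e₄)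
    ... | false | true | false | false = sym (cong (λ b → 𝟙 b + 0 + 0) (edge x y e₂ Auz))
    ... | false | false | true | true = ⊥-elim (apart x y (inj₁ (λ e → vu (sym e))) (inj₁ uz) e₃ e₄)
    ... | false | false | true | false = sym (cong (λ b → 𝟙 b + 1 + 0) (edge x y e₃ Auw))
    ... | false | false | false | true = sym (cong (λ b → 𝟙 b + 0 + 1) (edge x y e₄ Avz))
    ... | false | false | false | false = refl

    weighted-balance : ∀ x (W : Fin n → ℕ) →
      ∑ L (λ y → 𝟙 (A' x y) * W y) + (δ x v * W w + δ x w * W v) + (δ x u * W z + δ x z * W u)
      ≡ ∑ L (λ y → 𝟙 (A x y) * W y) + (δ x u * W w + δ x w * W u) + (δ x v * W z + δ x z * W v)
    weighted-balance x W = begin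
        ∑ L (f A') + (δ x v * W w + δ x w * W v) + (δ x u * W z + δ x z * W u)
          ≡⟨ cong₂ (λ p q → ∑ L (f A') + p + q) (sym (∑-samePair x v w vw W)) (sym (∑-samePair x u z uz W)) ⟩
        ∑ L (f A') + ∑ L (pair v w) + ∑ L (pair u z)
          ≡⟨ sym (trans (∑-+ L _ _) (cong (_+ ∑ L (pair u z)) (∑-+ L _ _))) ⟩
        ∑ L (λ y → f A' y + pair v w y + pair u z y)
          ≡⟨ ∑-cong L (λ y → trans (dist3 (𝟙 (A' x y)) _ _ (W y))
                             (trans (cong (_* W y) (edge-balance x y)) (sym (dist3 (𝟙 (A x y)) _ _ (W y))))) ⟩
        ∑ L (λ y → f A y + pair u w y + pair v z y)
          ≡⟨ trans (∑-+ L _ _) (cong (_+ ∑ L (pair v z)) (∑-+ L _ _)) ⟩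
        ∑ L (f A) + ∑ L (pair u w) + ∑ L (pair v z)
          ≡⟨ cong₂ (λ p q → ∑ L (f A) + p + q) (∑-samePair x u w uw W) (∑-samePair x v z vz W) ⟩
        ∑ L (f A) + (δ x u * W w + δ x w * W u) + (δ x v * W z + δ x z * W v) ∎
      where
        open ≡-Reasoning
        f : Adj n → Fin n → ℕ
        f G y = 𝟙 (G x y) * W y
        pair : Fin n → Fin n → Fin n → ℕ
        pair a b y = 𝟙 (samePair x y a b) * W y
        dist3 : ∀ a b c w → a * w + b * w + c * w ≡ (a + b + c) * w
        dist3 = solve-∀

    deg-preserved : ∀ x → deg A' x ≡ deg A x
    deg-preserved x = begin
        deg A' x                  ≡⟨ trans (deg-as-∑ A' x) (∑-cong L (λ y → sym (*-identityʳ _))) ⟩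
        ∑ L (λ y → 𝟙 (A' x y) * 1) ≡⟨ +-cancelʳ-≡ X _ _ balance ⟩
        ∑ L (λ y → 𝟙 (A x y) * 1)  ≡⟨ trans (∑-cong L (λ y → *-identityʳ _)) (sym (deg-as-∑ A x)) ⟩
        deg A x ∎
      where
        open ≡-Reasoning
        X = (δ x v * 1 + δ x w * 1) + (δ x u * 1 + δ x z * 1)
        regroup : ∀ a b c d → c * 1 + b * 1 + (a * 1 + d * 1) ≡ a * 1 + b * 1 + (c * 1 + d * 1)
        regroup = solve-∀
        balance : ∑ L (λ y → 𝟙 (A' x y) * 1) + X ≡ ∑ L (λ y → 𝟙 (A x y) * 1) + X
        balance = trans (sym (+-assoc (∑ L (λ y → 𝟙 (A' x y) * 1)) (δ x v * 1 + δ x w * 1) (δ x u * 1 + δ x z * 1)))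
                  (trans (weighted-balance x (λ _ → 1))
                  (trans (+-assoc (∑ L (λ y → 𝟙 (A x y) * 1)) (δ x u * 1 + δ x w * 1) (δ x v * 1 + δ x z * 1))
                         (cong (∑ L (λ y → 𝟙 (A x y) * 1) +_) (regroup (δ x v) (δ x w) (δ x u) (δ x z)))))

    spectrum-change : ∀ x i → s A' x i + δ x v * 𝟙 (deg A w ≡ᵇ i) + δ x u * 𝟙 (deg A z ≡ᵇ i)
                            ≡ s A x i + δ x v * 𝟙 (deg A z ≡ᵇ i) + δ x u * 𝟙 (deg A w ≡ᵇ i)
    spectrum-change x i = +-cancelʳ-≡ K _ _ (begin
        s A' x i + δ x v * W w + δ x u * W z + K
          ≡⟨ cong (λ t → t + δ x v * W w + δ x u * W z + K) s'-as-∑ ⟩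
        P' + δ x v * W w + δ x u * W z + K
          ≡⟨ regroup₁ P' (δ x v) (δ x w) (δ x u) (δ x z) (W w) (W v) (W z) ⟩
        P' + (δ x v * W w + δ x w * W v) + (δ x u * W z + δ x z * W v)
          ≡⟨ cong (λ t → P' + (δ x v * W w + δ x w * W v) + (δ x u * W z + δ x z * t)) (sym Wuv) ⟩
        P' + (δ x v * W w + δ x w * W v) + (δ x u * W z + δ x z * W u)
          ≡⟨ weighted-balance x W ⟩
        P + (δ x u * W w + δ x w * W u) + (δ x v * W z + δ x z * W v)
          ≡⟨ cong (λ t → P + (δ x u * W w + δ x w * t) + (δ x v * W z + δ x z * W v)) Wuv ⟩
        P + (δ x u * W w + δ x w * W v) + (δ x v * W z + δ x z * W v)
          ≡⟨ regroup₂ P (δ x v) (δ x w) (δ x u) (δ x z) (W w) (W v) (W z) ⟩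
        P + δ x v * W z + δ x u * W w + K
          ≡⟨ cong (λ t → t + δ x v * W z + δ x u * W w + K) (sym (s-as-∑ A x i)) ⟩
        s A x i + δ x v * W z + δ x u * W w + K ∎)
      where
        open ≡-Reasoning
        W : Fin n → ℕ
        W y = 𝟙 (deg A y ≡ᵇ i)
        P' = ∑ L (λ y → 𝟙 (A' x y) * W y)
        P = ∑ L (λ y → 𝟙 (A x y) * W y)
        K = δ x w * W v + δ x z * W v
        Wuv : W u ≡ W v
        Wuv = cong (λ d → 𝟙 (d ≡ᵇ i)) (sym dvu)
        s'-as-∑ : s A' x i ≡ P'
        s'-as-∑ = trans (s-as-∑ A' x i) (∑-cong L (λ y → cong (λ d → 𝟙 (A' x y) * 𝟙 (d ≡ᵇ i)) (deg-preserved y)))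
        regroup₁ : ∀ P a b c d ww wv wz → P + a * ww + c * wz + (b * wv + d * wv) ≡ P + (a * ww + b * wv) + (c * wz + d * wv)
        regroup₁ = solve-∀
        regroup₂ : ∀ P a b c d ww wv wz → P + (c * ww + b * wv) + (a * wz + d * wv) ≡ P + a * wz + c * ww + (b * wv + d * wv)
        regroup₂ = solve-∀

    symmetric' : Symmetric A'
    symmetric' x y =
      cong₂ (λ r a → if r then false else if a then true else A x y)
            (cong₂ _∨_ (samePair-comm x y v w) (samePair-comm x y u z))
            (cong₂ _∨_ (samePair-comm x y u w) (samePair-comm x y v z))
      ⟨trans⟩ cong (λ e → if samePair y x v w ∨ samePair y x u z then false
                          else if samePair y x u w ∨ samePair y x v z then true else e) (symA x y)
      where _⟨trans⟩_ = trans

    irreflexive' : Irreflexive A'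
    irreflexive' x =
      trans (cong₂ (λ r a → if r then false else if a then true else A x x)
                   (cong₂ _∨_ (samePair-diag x v w vw) (samePair-diag x u z uz))
                   (cong₂ _∨_ (samePair-diag x u w uw) (samePair-diag x v z vz)))
            (irr x)

module SwapCosts where

  open import Defs
  open FiniteSums
  open DoubleCounting using (spectrumMass)
  open CostFormula
  open import Data.Bool using (Bool; true; false)
  open import Data.Nat hiding (∣_-_∣; _/_)
  open import Data.Nat.Properties
  open import Data.Nat.Tactic.RingSolver using (solve-∀)
  open import Algebra.Properties.CommutativeSemigroup +-commutativeSemigroup using (interchange)
  open GraphBasics using (deg≤Δ)
  open import Data.Fin using (Fin)
  open import Data.List using (List; []; _∷_; filterᵇ; length; allFin; upTo; map; foldr)
  open import Data.List.Properties using (map-cong)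
  open import Data.Product using (_,_)
  open import Data.Sum using (inj₁; inj₂)
  open import Data.Empty using (⊥-elim)
  open import Relation.Binary.PropositionalEquality hiding (J)
  open import Relation.Nullary using (¬_)
  import Data.Integer as ℤ
  open import Data.Rational using (_-_; ∣_∣; floor; _/_)

  private
    filterᵇ-cong : ∀ {X : Set} {P Q : X → Bool} → (∀ x → P x ≡ Q x) → ∀ xs → filterᵇ P xs ≡ filterᵇ Q xs
    filterᵇ-cong h [] = refl
    filterᵇ-cong {P = P} {Q} h (x ∷ xs) with P x | Q x | h x
    ... | true | true | refl = cong (x ∷_) (filterᵇ-cong h xs)
    ... | false | false | refl = filterᵇ-cong h xs

  module Effect {n} (A : Adj n) (symA : Symmetric A) (irr : Irreflexive A) (v u w z : Fin n)
           (R : IsRSO A v u w z) where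

    open SwapEdges.Swapped A symA irr v u w z R public

    private
      L = allFin n
      W : Fin n → ℕ → ℕ
      W y i = 𝟙 (deg A y ≡ᵇ i)

      vertex-kinds : (h h' : Fin n → ℕ) → (∀ x → ¬ x ≡ v → ¬ x ≡ u → h' x ≡ h x) →
                     ∀ x → PointKind h h' (λ y → δ y v) (λ y → δ y u) v u x
      vertex-kinds h h' fixed x with δ-cases x v | δ-cases x u
      ... | inj₁ (refl , _) | inj₁ (refl , _) = ⊥-elim (vu refl)
      ... | inj₁ (refl , e₁) | inj₂ (_ , e₂) = inj₁ (e₁ , e₂ , refl , refl)
      ... | inj₂ (_ , e₁) | inj₁ (refl , e₂) = inj₂ (inj₁ (e₁ , e₂ , refl , refl))
      ... | inj₂ (nv , e₁) | inj₂ (nu , e₂) = inj₂ (inj₂ (e₁ , e₂ , fixed x nv nu))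

    V-preserved : ∀ j → V A' j ≡ V A j
    V-preserved j = filterᵇ-cong (λ x → cong (_≡ᵇ j) (deg-preserved x)) L

    range-preserved : range A' ≡ range A
    range-preserved = cong (λ d → map suc (upTo d)) (cong (foldr _⊔_ 0) (map-cong deg-preserved L))

    spectrum-fixed : ∀ x i → ¬ x ≡ v → ¬ x ≡ u → s A' x i ≡ s A x i
    spectrum-fixed x i nv nu with spectrum-change x i
    ... | e rewrite δ-≢ nv | δ-≢ nu = trans (sym (tidy (s A' x i) (W w i) (W z i))) (trans e (tidy (s A x i) (W z i) (W w i)))
      where tidy : ∀ a b c → a + 0 * b + 0 * c ≡ a
            tidy = solve-∀

    spectrum-v : ∀ i → s A' v i + W w i ≡ s A v i + W z i
    spectrum-v i with spectrum-change v i
    ... | e rewrite δ-refl v | δ-≢ vu = trans (sym (tidy (s A' v i) (W w i) (W z i))) (trans e (tidy (s A v i) (W z i) (W w i)))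
      where tidy : ∀ a b c → a + 1 * b + 0 * c ≡ a + b
            tidy = solve-∀

    spectrum-u : ∀ i → s A' u i + W z i ≡ s A u i + W w i
    spectrum-u i with spectrum-change u i
    ... | e rewrite δ-≢ (λ e → vu (sym e)) | δ-refl u = trans (sym (tidy (s A' u i) (W z i) (W w i))) (trans e (tidy (s A u i) (W w i) (W z i)))
      where tidy : ∀ a b c → a + 0 * c + 1 * b ≡ a + b
            tidy = solve-∀

    -- p_i is preserved: v and u lie in the same class and their total spectrum is kept
    mass-preserved : ∀ j i → spectrumMass A' j i ≡ spectrumMass A j i
    mass-preserved j i = begin
        spectrumMass A' j i ≡⟨ ∑-cong L (λ x → cong (λ d → 𝟙 (d ≡ᵇ j) * s A' x i) (deg-preserved x)) ⟩
        ∑ L h'              ≡⟨ +-cancelʳ-≡ (h v + h u) _ _ exchanged ⟩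
        ∑ L h ∎
      where
        open ≡-Reasoning
        D : Fin n → ℕ
        D x = 𝟙 (deg A x ≡ᵇ j)
        h h' : Fin n → ℕ
        h x = D x * s A x i
        h' x = D x * s A' x i
        Duv : D u ≡ D v
        Duv = cong (λ d → 𝟙 (d ≡ᵇ j)) (sym dvu)
        pair-total : s A' v i + s A' u i ≡ s A v i + s A u i
        pair-total = +-cancelʳ-≡ (W w i + W z i) _ _ (begin
            s A' v i + s A' u i + (W w i + W z i) ≡⟨ interchange (s A' v i) (s A' u i) (W w i) (W z i) ⟩
            (s A' v i + W w i) + (s A' u i + W z i) ≡⟨ cong₂ _+_ (spectrum-v i) (spectrum-u i) ⟩
            (s A v i + W z i) + (s A u i + W w i) ≡⟨ shuffle′ (s A v i) (s A u i) (W w i) (W z i) ⟩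
            s A v i + s A u i + (W w i + W z i) ∎)
          where
            shuffle′ : ∀ a b c d → (a + d) + (b + c) ≡ a + b + (c + d)
            shuffle′ = solve-∀
        pair-weighted : h' v + h' u ≡ h v + h u
        pair-weighted = begin
            D v * s A' v i + D u * s A' u i ≡⟨ cong (λ t → D v * s A' v i + t * s A' u i) Duv ⟩
            D v * s A' v i + D v * s A' u i ≡⟨ trans (sym (*-distribˡ-+ (D v) _ _)) (cong (D v *_) pair-total) ⟩
            D v * (s A v i + s A u i)       ≡⟨ *-distribˡ-+ (D v) _ _ ⟩
            D v * s A v i + D v * s A u i   ≡⟨ cong (λ t → D v * s A v i + t * s A u i) (sym Duv) ⟩
            D v * s A v i + D u * s A u i ∎
        exchanged : ∑ L h' + (h v + h u) ≡ ∑ L h + (h v + h u)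
        exchanged = trans (∑-change-at-two L h h' (λ y → δ y v) (λ y → δ y u) v u (∑-allFin-δ n v) (∑-allFin-δ n u)
                             (vertex-kinds h h' (λ x nv nu → cong (D x *_) (spectrum-fixed x i nv nu))))
                          (cong (∑ L h +_) pair-weighted)

    Avg-preserved : ∀ j i → Avg A' j i ≡ Avg A j i
    Avg-preserved j i =
      trans (Avg-as-mass A' symmetric' irreflexive' j i)
            (trans (cong₂ fraction (cong length (V-preserved j)) (mass-preserved j i)) (sym (Avg-as-mass A symA irr j i)))

    cost-preserved : ∀ x i → s A' x i ≡ s A x i → cN A' x i ≡ cN A x i
    cost-preserved x i e = cong ℤ.∣_∣ (cong₂ (λ a t → floor ∣ a - ((ℤ.+ t) / 1) ∣)
                                             (trans (cong (λ d → Avg A' d i) (deg-preserved x)) (Avg-preserved (deg A x) i)) e)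

    vertexCost-fixed : ∀ x → ¬ x ≡ v → ¬ x ≡ u → vertexCost A' x ≡ vertexCost A x
    vertexCost-fixed x nv nu =
      trans (cong (λ l → ∑ l (cN A' x)) range-preserved)
            (∑-cong (range A) (λ i → cost-preserved x i (spectrum-fixed x i nv nu)))

    classCost-other : ∀ j ℓ → deg A v ≡ j → ¬ ℓ ≡ j → classCost A' ℓ ≡ classCost A ℓ
    classCost-other j ℓ dv ne =
      trans (cong (λ l → ∑ l (vertexCost A')) (V-preserved ℓ))
            (trans (∑-filter (λ x → deg A x ≡ᵇ ℓ) L (vertexCost A'))
                   (trans (∑-cong L (λ x → 𝟙-*-cong (deg A x ≡ᵇ ℓ) (λ e → vertexCost-fixed x (not-v x e) (not-u x e))))
                          (sym (classCost-as-∑ A ℓ))))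
      where
        not-v : ∀ x → (deg A x ≡ᵇ ℓ) ≡ true → ¬ x ≡ v
        not-v x e refl = ne (trans (sym (≡ᵇ-true e)) dv)
        not-u : ∀ x → (deg A x ≡ᵇ ℓ) ≡ true → ¬ x ≡ u
        not-u x e refl = ne (trans (sym (≡ᵇ-true e)) (trans (sym dvu) dv))

    classCost-decrease : ∀ j → deg A v ≡ j → vertexCost A' v + vertexCost A' u < vertexCost A v + vertexCost A u →
                         classCost A' j < classCost A j
    classCost-decrease j dv lt =
      subst₂ _<_ (sym class') (sym (classCost-as-∑ A j))
        (cancel-< (∑ L h') (∑ L h) (h v + h u) (h' v + h' u) exchanged (subst₂ _<_ (sym (on-pair F')) (sym (on-pair F)) lt))
      where
        F = vertexCost A
        F' = vertexCost A'
        D : Fin n → ℕ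
        D x = 𝟙 (deg A x ≡ᵇ j)
        h h' : Fin n → ℕ
        h x = D x * F x
        h' x = D x * F' x
        on-pair : ∀ f → D v * f v + D u * f u ≡ f v + f u
        on-pair f = cong₂ _+_ (trans (cong (λ d → 𝟙 (d ≡ᵇ j) * f v) dv) (trans (cong (_* f v) (𝟙-≡ᵇ-refl j)) (+-identityʳ _)))
                              (trans (cong (λ d → 𝟙 (d ≡ᵇ j) * f u) (trans (sym dvu) dv))
                                     (trans (cong (_* f u) (𝟙-≡ᵇ-refl j)) (+-identityʳ _)))
        class' : classCost A' j ≡ ∑ L h'
        class' = trans (cong (λ l → ∑ l F') (V-preserved j)) (∑-filter (λ x → deg A x ≡ᵇ j) L F')
        exchanged : ∑ L h' + (h v + h u) ≡ ∑ L h + (h' v + h' u)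
        exchanged = ∑-change-at-two L h h' (λ y → δ y v) (λ y → δ y u) v u (∑-allFin-δ n v) (∑-allFin-δ n u)
                      (vertex-kinds h h' (λ x nv nu → cong (D x *_) (vertexCost-fixed x nv nu)))

    vertexCost-change : ∀ x I K → 1 ≤ I → I ≤ Δ A → 1 ≤ K → K ≤ Δ A → ¬ I ≡ K →
                        (∀ i → ¬ i ≡ I → ¬ i ≡ K → s A' x i ≡ s A x i) →
                        vertexCost A' x + (cN A x I + cN A x K) ≡ vertexCost A x + (cN A' x I + cN A' x K)
    vertexCost-change x I K I≥1 I≤Δ K≥1 K≤Δ I≢K fixed =
      trans (cong (λ l → ∑ l (cN A' x) + (cN A x I + cN A x K)) range-preserved)
            (∑-change-at-two (range A) (cN A x) (cN A' x) (λ i → 𝟙 (i ≡ᵇ I)) (λ i → 𝟙 (i ≡ᵇ K)) I K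
               (∑-range-δ (Δ A) I I≥1 I≤Δ) (∑-range-δ (Δ A) K K≥1 K≤Δ) index-kinds)
      where
        index-kinds = indices-apart (cN A x) (cN A' x) I K I≢K (λ i p q → cost-preserved x i (fixed i p q))

    spectrum-v-elsewhere : ∀ i → ¬ i ≡ deg A w → ¬ i ≡ deg A z → s A' v i ≡ s A v i
    spectrum-v-elsewhere i p q = +-cancelʳ-≡ 0 _ _
      (trans (cong (s A' v i +_) (sym (𝟙-≡ᵇ-≢ (λ e → p (sym e)))))
             (trans (spectrum-v i) (cong (s A v i +_) (𝟙-≡ᵇ-≢ (λ e → q (sym e))))))

    spectrum-u-elsewhere : ∀ i → ¬ i ≡ deg A w → ¬ i ≡ deg A z → s A' u i ≡ s A u i
    spectrum-u-elsewhere i p q = +-cancelʳ-≡ 0 _ _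
      (trans (cong (s A' u i +_) (sym (𝟙-≡ᵇ-≢ (λ e → q (sym e)))))
             (trans (spectrum-u i) (cong (s A u i +_) (𝟙-≡ᵇ-≢ (λ e → p (sym e))))))

    pair-cost-decrease : NoIsolated A → ¬ deg A w ≡ deg A z →
      cN A' v (deg A w) + cN A' u (deg A w) < cN A v (deg A w) + cN A u (deg A w) →
      cN A' v (deg A z) + cN A' u (deg A z) ≤ cN A v (deg A z) + cN A u (deg A z) →
      vertexCost A' v + vertexCost A' u < vertexCost A v + vertexCost A u
    pair-cost-decrease noIso I≢K ltI leK = cancel-< (F' v + F' u) (F v + F u) (X v + X u) (X' v + X' u) balance smaller
      where
        open ≡-Reasoning
        I = deg A w
        K = deg A z
        F F' X X' : Fin n → ℕ
        F = vertexCost A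
        F' = vertexCost A'
        X x = cN A x I + cN A x K
        X' x = cN A' x I + cN A' x K
        positive : ∀ x → 1 ≤ deg A x
        positive x = n≢0⇒n>0 (noIso x)
        change : ∀ x → (∀ i → ¬ i ≡ I → ¬ i ≡ K → s A' x i ≡ s A x i) → F' x + X x ≡ F x + X' x
        change x = vertexCost-change x I K (positive w) (deg≤Δ A w) (positive z) (deg≤Δ A z) I≢K
        balance : F' v + F' u + (X v + X u) ≡ F v + F u + (X' v + X' u)
        balance = begin
          F' v + F' u + (X v + X u)       ≡⟨ interchange (F' v) (F' u) (X v) (X u) ⟩
          (F' v + X v) + (F' u + X u)     ≡⟨ cong₂ _+_ (change v spectrum-v-elsewhere) (change u spectrum-u-elsewhere) ⟩
          (F v + X' v) + (F u + X' u)     ≡⟨ interchange (F v) (X' v) (F u) (X' u) ⟩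
          F v + F u + (X' v + X' u) ∎
        smaller : X' v + X' u < X v + X u
        smaller = subst₂ _<_ (interchange (cN A' v I) (cN A' u I) (cN A' v K) (cN A' u K))
                             (interchange (cN A v I) (cN A u I) (cN A v K) (cN A u K))
                             (+-mono-<-≤ ltI leK)

-- Here the class is given by a
-- Boolean test D of size q, f is any quantity, and p = Σ_{D y} f y is q times the mean.
module Averaging where

  open FiniteSums
  open GraphBasics using (find)
  open DistanceQuotient using (Straddle)
  open import Data.Bool using (Bool; true; false; _∧_; T)
  open import Data.Nat
  open import Data.Nat.Properties
  open import Data.Nat.Tactic.RingSolver using (solve-∀)
  open import Data.Fin using (Fin)
  open import Data.List using (allFin)
  open import Data.Product using (Σ; _×_; _,_)
  open import Data.Sum using (_⊎_; inj₁; inj₂)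
  open import Data.Empty using (⊥-elim)
  open import Relation.Binary.PropositionalEquality
  open import Relation.Nullary using (¬_)

  module _ {n} (D : Fin n → Bool) (f : Fin n → ℕ) (k : ℕ) (size : ∑ (allFin n) (λ y → 𝟙 (D y)) ≡ suc k) where

    private
      L = allFin n
      q = suc k
      p = ∑ L (λ y → 𝟙 (D y) * f y)

      ∧-split : ∀ {a b} → a ∧ b ≡ true → (a ≡ true) × (b ≡ true)
      ∧-split {true} {true} _ = refl , refl

      ∧-right : ∀ {a b} → a ≡ true → a ∧ b ≡ false → b ≡ false
      ∧-right refl e = e

      <ᵇ-true : ∀ {a b} → (a <ᵇ b) ≡ true → a < b
      <ᵇ-true {a} {b} e = <ᵇ⇒< a b (subst T (sym e) _)

      <ᵇ-false : ∀ {a b} → (a <ᵇ b) ≡ false → b ≤ a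
      <ᵇ-false e = ≮⇒≥ (λ lt → subst T e (<⇒<ᵇ lt))

      ∑-const : ∀ c → ∑ L (λ y → 𝟙 (D y) * c) ≡ q * c
      ∑-const c = trans (∑-cong L (λ y → *-comm (𝟙 (D y)) c)) (trans (∑-*ˡ L c (λ y → 𝟙 (D y))) (trans (cong (c *_) size) (*-comm c q)))

      ∑-scaled : ∑ L (λ y → 𝟙 (D y) * (q * f y)) ≡ q * p
      ∑-scaled = trans (∑-cong L (λ y → swap-factors (𝟙 (D y)) q (f y))) (∑-*ˡ L q (λ y → 𝟙 (D y) * f y))
        where swap-factors : ∀ a b c → a * (b * c) ≡ b * (a * c)
              swap-factors = solve-∀

      ∑-point : ∀ x₀ c → D x₀ ≡ true → ∑ L (λ y → 𝟙 (D y) * (c * δ y x₀)) ≡ c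
      ∑-point x₀ c Dx₀ =
        trans (∑-cong L (λ y → rotate (𝟙 (D y)) c (δ y x₀)))
              (trans (∑-δ-Fin x₀ (λ y → 𝟙 (D y) * c)) (trans (cong (λ b → 𝟙 b * c) Dx₀) (+-identityʳ c)))
        where rotate : ∀ a b d → a * (b * d) ≡ d * (a * b)
              rotate = solve-∀

      bumped : ∀ x₀ (lo hi : Fin n → ℕ) → (∀ y → D y ≡ true → lo y ≤ hi y) → lo x₀ + q ≤ hi x₀ →
               ∀ y → 𝟙 (D y) * (lo y + q * δ y x₀) ≤ 𝟙 (D y) * hi y
      bumped x₀ lo hi bound h y = 𝟙-*-mono (D y) at-y
        where
          at-y : D y ≡ true → lo y + q * δ y x₀ ≤ hi y
          at-y Dy with δ-cases y x₀
          ... | inj₁ (refl , e) rewrite e | *-identityʳ q = h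
          ... | inj₂ (_ , e) rewrite e | *-zeroʳ q | +-identityʳ (lo y) = bound y Dy

      overfull : ∀ x₀ (lo hi : Fin n → ℕ) → D x₀ ≡ true →
                 ∑ L (λ y → 𝟙 (D y) * lo y) ≡ q * p → ∑ L (λ y → 𝟙 (D y) * hi y) ≡ q * p →
                 (∀ y → D y ≡ true → lo y ≤ hi y) → ¬ lo x₀ + q ≤ hi x₀
      overfull x₀ lo hi Dx₀ lo-total hi-total bound h = q≰0 (+-cancelˡ-≤ (q * p) q 0 (begin
          q * p + q                                  ≡⟨ sym (cong₂ _+_ lo-total (∑-point x₀ q Dx₀)) ⟩
          ∑ L (λ y → 𝟙 (D y) * lo y) + ∑ L (λ y → 𝟙 (D y) * (q * δ y x₀))
            ≡⟨ sym (trans (∑-cong L (λ y → *-distribˡ-+ (𝟙 (D y)) (lo y) _)) (∑-+ L _ _)) ⟩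
          ∑ L (λ y → 𝟙 (D y) * (lo y + q * δ y x₀)) ≤⟨ ∑-mono L (bumped x₀ lo hi bound h) ⟩
          ∑ L (λ y → 𝟙 (D y) * hi y)                ≡⟨ trans hi-total (sym (+-identityʳ (q * p))) ⟩
          q * p + 0 ∎))
        where
          open ≤-Reasoning
          q≰0 : ¬ q ≤ 0
          q≰0 ()

    above-partner : ∀ x₀ → D x₀ ≡ true → p + q ≤ q * f x₀ → Σ (Fin n) (λ y → D y ≡ true × q * f y < p)
    above-partner x₀ Dx₀ h with find (λ y → D y ∧ (q * f y <ᵇ p))
    ... | inj₁ (y , e) = let (Dy , lt) = ∧-split e in y , Dy , <ᵇ-true lt
    ... | inj₂ none = ⊥-elim (overfull x₀ (λ _ → p) (λ y → q * f y) Dx₀ (∑-const p) ∑-scaled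
                                        (λ y Dy → <ᵇ-false (∧-right Dy (none y))) h)

    below-partner : ∀ x₀ → D x₀ ≡ true → q * f x₀ + q ≤ p → Σ (Fin n) (λ y → D y ≡ true × p < q * f y)
    below-partner x₀ Dx₀ h with find (λ y → D y ∧ (p <ᵇ q * f y))
    ... | inj₁ (y , e) = let (Dy , lt) = ∧-split e in y , Dy , <ᵇ-true lt
    ... | inj₂ none = ⊥-elim (overfull x₀ (λ y → q * f y) (λ _ → p) Dx₀ ∑-scaled (∑-const p)
                                        (λ y Dy → <ᵇ-false (∧-right Dy (none y))) h)

    straddling-pair : ∀ x₀ → D x₀ ≡ true → (q * f x₀ + q ≤ p) ⊎ (p + q ≤ q * f x₀) →
                      Σ (Fin n) λ v → Σ (Fin n) λ u → D v ≡ true × D u ≡ true × Straddle p k (q * f v) (q * f u)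
    straddling-pair x₀ Dx₀ (inj₂ h) = let (y , Dy , lt) = above-partner x₀ Dx₀ h in x₀ , y , Dx₀ , Dy , inj₁ (h , lt)
    straddling-pair x₀ Dx₀ (inj₁ h) = let (y , Dy , gt) = below-partner x₀ Dx₀ h in y , x₀ , Dy , Dx₀ , inj₂ (gt , h)

-- If d(v) = d(u) and s(v,I) ≥ s(u,I) + 2, then
--  * v has a neighbour w of degree I with w ≠ u and uw ∉ E (counting neighbours of degree I);
--  * u has a neighbour z ≠ v with vz ∉ E and s(v,d(z)) < s(u,d(z)) (otherwise each
--    s(u,k) ≤ s(v,k) + [d(v) = k], and summing over k contradicts d(u) = d(v)).
module SwapWitnesses where

  open import Defs
  open FiniteSums
  open GraphBasics
  open import Data.Bool using (Bool; true; false; _∧_; not; T)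
  open import Data.Nat
  open import Data.Nat.Properties
  open import Data.Fin using (Fin)
  import Data.Fin as Fin
  open import Data.List using (allFin; upTo)
  open import Data.Product using (Σ; _×_; _,_)
  open import Data.Sum using (inj₁; inj₂)
  open import Data.Empty using (⊥-elim)
  open import Relation.Binary.PropositionalEquality
  open import Relation.Nullary using (¬_; yes; no; does)
  open import Relation.Nullary.Decidable using (dec-true)

  private
    does-false : ∀ {n} {x y : Fin n} → does (x Fin.≟ y) ≡ false → ¬ x ≡ y
    does-false {x = x} {y} e p with trans (sym e) (dec-true (x Fin.≟ y) p)
    ... | ()

    w-test : ∀ α β γ ε → α ∧ β ∧ not γ ∧ not ε ≡ true → (α ≡ true) × (β ≡ true) × (γ ≡ false) × (ε ≡ false)
    w-test true true false false _ = refl , refl , refl , refl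

    w-fails : ∀ α β γ ε → α ∧ β ∧ not γ ∧ not ε ≡ false → 𝟙 α * 𝟙 β ≤ 𝟙 γ * 𝟙 β + 𝟙 ε
    w-fails true true true ε _ = s≤s z≤n
    w-fails true true false true _ = s≤s z≤n
    w-fails true false γ ε _ = z≤n
    w-fails false β γ ε _ = z≤n

    z-test : ∀ α β ε τ → α ∧ not β ∧ not ε ∧ τ ≡ true → (α ≡ true) × (β ≡ false) × (ε ≡ false) × (τ ≡ true)
    z-test true false false true _ = refl , refl , refl , refl

    z-fails : ∀ α β ε τ → α ∧ not β ∧ not ε ∧ τ ≡ false → τ ≡ true → 𝟙 α ≤ 𝟙 β + 𝟙 ε
    z-fails true true ε τ _ _ = s≤s z≤n
    z-fails true false true τ _ _ = s≤s z≤n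
    z-fails true false false true () _
    z-fails false β ε τ _ _ = z≤n

  module _ {n} (A : Adj n) (v u : Fin n) (I : ℕ) (dvu : deg A v ≡ deg A u) (gap : s A u I + 2 ≤ s A v I) where

    private
      L = allFin n

    neighbour-w : Σ (Fin n) (λ w → (A v w ≡ true) × (deg A w ≡ I) × (A u w ≡ false) × ¬ w ≡ u)
    neighbour-w with find (λ w → A v w ∧ (deg A w ≡ᵇ I) ∧ not (A u w) ∧ not (does (w Fin.≟ u)))
    ... | inj₁ (w , e) = let (e₁ , e₂ , e₃ , e₄) = w-test (A v w) (deg A w ≡ᵇ I) (A u w) (does (w Fin.≟ u)) e
                         in w , e₁ , ≡ᵇ-true e₂ , e₃ , does-false e₄
    ... | inj₂ none = ⊥-elim (<⇒≱ (subst (_≤ s A v I) (+-suc (s A u I) 1) gap) at-most-one-more)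
      where
        W : Fin n → ℕ
        W y = 𝟙 (deg A y ≡ᵇ I)
        -- every neighbour of v of degree I is a neighbour of u, or u itself
        at-most-one-more : s A v I ≤ s A u I + 1
        at-most-one-more =
          subst₂ _≤_ (sym (s-as-∑ A v I)) (trans (∑-+ L _ _) (cong₂ _+_ (sym (s-as-∑ A u I)) (∑-δ-Fin u (λ _ → 1))))
            (∑-mono L (λ y → subst (𝟙 (A v y) * W y ≤_) (cong (𝟙 (A u y) * W y +_) (sym (*-identityʳ (δ y u))))
                                   (w-fails (A v y) (deg A y ≡ᵇ I) (A u y) (does (y Fin.≟ u)) (none y))))

    neighbour-z : I ≤ n → Σ (Fin n) (λ z → (A u z ≡ true) × (A v z ≡ false) × ¬ z ≡ v × s A v (deg A z) < s A u (deg A z))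
    neighbour-z I≤n with find (λ z → A u z ∧ not (A v z) ∧ not (does (z Fin.≟ v)) ∧ (s A v (deg A z) <ᵇ s A u (deg A z)))
    ... | inj₁ (z , e) = let (e₁ , e₂ , e₃ , e₄) = z-test (A u z) (A v z) (does (z Fin.≟ v)) _ e
                         in z , e₁ , e₂ , does-false e₃ , <ᵇ⇒< _ _ (subst T (sym e₄) _)
    ... | inj₂ none = ⊥-elim (<⇒≱ (n<1+n (deg A v + 1)) (subst (_≤ deg A v + 1) (+-suc (deg A v) 1) degree-bound))
      where
        U = upTo (suc n)
        -- where u has more neighbours of degree k, they are all neighbours of v or v itself
        dominated : ∀ k → s A u k ≤ s A v k + 𝟙 (deg A v ≡ᵇ k)
        dominated k with s A v k <? s A u k
        ... | no ≮ = ≤-trans (≮⇒≥ ≮) (m≤m+n _ _)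
        ... | yes lt =
          subst₂ _≤_ (sym (s-as-∑ A u k))
                     (trans (∑-cong L (λ y → *-distribʳ-+ (𝟙 (deg A y ≡ᵇ k)) (𝟙 (A v y)) (δ y v)))
                            (trans (∑-+ L _ _) (cong₂ _+_ (sym (s-as-∑ A v k)) (∑-δ-Fin v (λ y → 𝟙 (deg A y ≡ᵇ k))))))
                     (∑-mono L (λ y → subst₂ _≤_ (*-comm (𝟙 (deg A y ≡ᵇ k)) _) (*-comm (𝟙 (deg A y ≡ᵇ k)) _)
                                          (𝟙-*-mono (deg A y ≡ᵇ k) (not-a-z y))))
          where
            not-a-z : ∀ y → (deg A y ≡ᵇ k) ≡ true → 𝟙 (A u y) ≤ 𝟙 (A v y) + δ y v
            not-a-z y e = z-fails (A u y) (A v y) (does (y Fin.≟ v)) _ (none y)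
                            (subst (λ t → (s A v t <ᵇ s A u t) ≡ true) (sym (≡ᵇ-true e)) (≡T (<⇒<ᵇ lt)))
              where ≡T : ∀ {b} → T b → b ≡ true
                    ≡T {true} _ = refl
        pointwise : ∀ k → s A u k + 2 * 𝟙 (k ≡ᵇ I) ≤ s A v k + 𝟙 (deg A v ≡ᵇ k)
        pointwise k with k ≟ I
        ... | yes refl rewrite 𝟙-≡ᵇ-refl k = ≤-trans gap (m≤m+n _ _)
        ... | no ne rewrite 𝟙-≡ᵇ-≢ ne | +-identityʳ (s A u k) = dominated k
        degree-bound : deg A v + 2 ≤ deg A v + 1
        degree-bound =
          subst₂ _≤_ (trans (∑-+ U (s A u) (λ k → 2 * 𝟙 (k ≡ᵇ I)))
                            (cong₂ _+_ (trans (spectrum-sum A u) (sym dvu))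
                                       (trans (∑-*ˡ U 2 (λ k → 𝟙 (k ≡ᵇ I))) (cong (2 *_) (∑-upTo-δ (suc n) I (s≤s I≤n))))))
                     (trans (∑-+ U (s A v) (λ k → 𝟙 (deg A v ≡ᵇ k)))
                            (cong₂ _+_ (spectrum-sum A v)
                                       (trans (∑-cong U (λ k → cong 𝟙 (≡ᵇ-comm (deg A v) k))) (∑-upTo-δ (suc n) (deg A v) (s≤s (deg≤n A v))))))
                     (∑-mono U pointwise)

-- Let v, u ∈ V_j, |V_j| = q = k + 1, and let the scaled counts
-- q·s(v,i), q·s(u,i) straddle p_i.  With w, z from SwapWitnesses the swap
-- vw,uz ⇒ vz,uw is restricted, lowers C(j) and keeps every other C(ℓ): at index i
-- one unit passes from v (above p_i) to u (below), which lowers their cost; at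
-- K = d(z) one unit passes from u to v, where s(v,K) < s(u,K), which cannot raise it.
module Improvement where

  open import Defs
  open FiniteSums
  open GraphBasics using (deg≤n)
  open DistanceQuotient
  open DoubleCounting using (spectrumMass)
  open CostFormula
  open SwapWitnesses
  open import Data.Bool using (true; false)
  open import Data.Nat
  open import Data.Nat.Properties
  open import Data.Fin using (Fin)
  open import Data.List using (length)
  open import Data.Product using (_,_; proj₁)
  open import Data.Empty using (⊥)
  import Data.Integer as ℤ
  open import Relation.Binary.PropositionalEquality hiding (J)
  open import Relation.Nullary using (¬_)

  module ImprovingSwap {n} (A : Adj n) (symA : Symmetric A) (irr : Irreflexive A) (noIso : NoIsolated A)
                       (j k i : ℕ) (len : length (V A j) ≡ suc k)
                       (v u : Fin n) (dv : deg A v ≡ j) (du : deg A u ≡ j)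
                       (straddle : Straddle (spectrumMass A j i) k (suc k * s A v i) (suc k * s A u i)) where

    private
      q = suc k
      p : ℕ → ℕ
      p = spectrumMass A j

      false≢true : false ≡ true → ⊥
      false≢true ()

      shift : ∀ {a b c d} → a + c ≡ b + d → c ≡ 1 → d ≡ 0 → b ≡ suc a
      shift {a} {b} e refl refl = trans (sym (+-identityʳ b)) (trans (sym e) (+-comm a 1))

    dvu : deg A v ≡ deg A u
    dvu = trans dv (sym du)

    gap : s A u i + 2 ≤ s A v i
    gap = subst (_≤ s A v i) (+-comm 2 (s A u i))
                (*-cancelˡ-< q (suc (s A u i)) (s A v i)
                   (subst (_< q * s A v i) (sym (*-suc′ q (s A u i))) (straddle-gap (p i) k straddle)))

    private
      found-w = neighbour-w A v u i dvu gap

    w : Fin n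
    w = proj₁ found-w
    Avw : A v w ≡ true
    Avw = let (_ , h , _) = found-w in h
    dw : deg A w ≡ i
    dw = let (_ , _ , h , _) = found-w in h
    Auw : A u w ≡ false
    Auw = let (_ , _ , _ , h , _) = found-w in h
    w≢u : ¬ w ≡ u
    w≢u = let (_ , _ , _ , _ , h) = found-w in h

    private
      found-z = neighbour-z A v u i dvu gap (subst (_≤ n) dw (deg≤n A w))

    z : Fin n
    z = proj₁ found-z
    Auz : A u z ≡ true
    Auz = let (_ , h , _) = found-z in h
    Avz : A v z ≡ false
    Avz = let (_ , _ , h , _) = found-z in h
    z≢v : ¬ z ≡ v
    z≢v = let (_ , _ , _ , h , _) = found-z in h
    fewer-at-K : s A v (deg A z) < s A u (deg A z)
    fewer-at-K = let (_ , _ , _ , _ , h) = found-z in h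

    K : ℕ
    K = deg A z

    i≢K : ¬ i ≡ K
    i≢K e = <⇒≱ (subst (λ t → s A v t < s A u t) (sym e) fewer-at-K) (≤-trans (m≤m+n (s A u i) 2) gap)

    v≢u : ¬ v ≡ u
    v≢u e = m+1+n≰m (s A u i) (subst (λ x → s A u i + 2 ≤ s A x i) e gap)

    rso : IsRSO A v u w z
    rso = ( v≢u
          , (λ e → false≢true (trans (sym (irr v)) (subst (λ t → A v t ≡ true) (sym e) Avw)))
          , (λ e → z≢v (sym e))
          , (λ e → w≢u (sym e))
          , (λ e → false≢true (trans (sym (irr u)) (subst (λ t → A u t ≡ true) (sym e) Auz)))
          , (λ e → i≢K (trans (sym dw) (cong (deg A) e)))
          , Avw , Auz , Auw , Avz ) , dvu

    open SwapCosts.Effect A symA irr v u w z rso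

    cost-before : ∀ x i′ → deg A x ≡ j → cN A x i′ ≡ distQ (p i′) k (q * s A x i′)
    cost-before x i′ dx = cost-formula A symA irr x i′ j k dx len

    cost-after : ∀ x i′ → deg A x ≡ j → cN A' x i′ ≡ distQ (p i′) k (q * s A' x i′)
    cost-after x i′ dx =
      trans (cost-formula A' symmetric' irreflexive' x i′ j k (trans (deg-preserved x) dx) (trans (cong length (V-preserved j)) len))
            (cong (λ t → distQ t k (q * s A' x i′)) (mass-preserved j i′))

    private
      w-at-i : 𝟙 (deg A w ≡ᵇ i) ≡ 1
      w-at-i = trans (cong (λ t → 𝟙 (t ≡ᵇ i)) dw) (𝟙-≡ᵇ-refl i)
      z-at-i : 𝟙 (deg A z ≡ᵇ i) ≡ 0
      z-at-i = 𝟙-≡ᵇ-≢ (λ e → i≢K (sym e))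
      w-at-K : 𝟙 (deg A w ≡ᵇ K) ≡ 0
      w-at-K = 𝟙-≡ᵇ-≢ (λ e → i≢K (trans (sym dw) e))
      z-at-K : 𝟙 (deg A z ≡ᵇ K) ≡ 1
      z-at-K = 𝟙-≡ᵇ-refl K

    v-loses-at-i : s A v i ≡ suc (s A' v i)
    v-loses-at-i = shift (spectrum-v i) w-at-i z-at-i

    u-gains-at-i : s A' u i ≡ suc (s A u i)
    u-gains-at-i = shift (sym (spectrum-u i)) w-at-i z-at-i

    v-gains-at-K : s A' v K ≡ suc (s A v K)
    v-gains-at-K = shift (sym (spectrum-v K)) z-at-K w-at-K

    u-loses-at-K : s A u K ≡ suc (s A' u K)
    u-loses-at-K = shift (spectrum-u K) z-at-K w-at-K

    cost-drops-at-i : cN A' v i + cN A' u i < cN A v i + cN A u i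
    cost-drops-at-i =
      subst₂ _<_ (cong₂ _+_ (sym (cost-after v i dv)) (trans (cong (λ t → d (q * t)) (sym u-gains-at-i)) (sym (cost-after u i du))))
                 (cong₂ _+_ (trans (cong (λ t → d (q * t)) (sym v-loses-at-i)) (sym (cost-before v i dv))) (sym (cost-before u i du)))
                 (distQ-transfer-strict (p i) k (s A' v i) (s A u i)
                    (subst (λ t → Straddle (p i) k (q * t) (q * s A u i)) v-loses-at-i straddle))
      where d = distQ (p i) k

    cost-no-rise-at-K : cN A' v K + cN A' u K ≤ cN A v K + cN A u K
    cost-no-rise-at-K =
      subst₂ _≤_ (cong₂ _+_ (trans (cong (λ t → d (q * t)) (sym v-gains-at-K)) (sym (cost-after v K dv))) (sym (cost-after u K du)))
                 (cong₂ _+_ (sym (cost-before v K dv)) (trans (cong (λ t → d (q * t)) (sym u-loses-at-K)) (sym (cost-before u K du))))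
                 (distQ-transfer-weak (p K) k (s A v K) (s A' u K) (s≤s⁻¹ (subst (s A v K <_) u-loses-at-K fewer-at-K)))
      where d = distQ (p K) k

    C-decreases : C A' j ℤ.< C A j
    C-decreases =
      subst₂ ℤ._<_ (sym (C-as-classCost A' j)) (sym (C-as-classCost A j))
        (ℤ.+<+ (classCost-decrease j dv
                  (pair-cost-decrease noIso (λ e → i≢K (trans (sym dw) e))
                     (subst (λ t → cN A' v t + cN A' u t < cN A v t + cN A u t) (sym dw) cost-drops-at-i)
                     cost-no-rise-at-K)))

    C-others : ∀ ℓ → ¬ ℓ ≡ j → C A' ℓ ≡ C A ℓ
    C-others ℓ ne = trans (C-as-classCost A' ℓ) (trans (cong ℤ.+_ (classCost-other j ℓ dv ne)) (sym (C-as-classCost A ℓ)))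

module Imbalance where

  open import Defs
  open FiniteSums
  open GraphBasics using (V-length; V-member)
  open DistanceQuotient using (distQ-nonzero; Straddle)
  open DoubleCounting using (spectrumMass)
  open CostFormula
  open Averaging using (straddling-pair)
  open import Data.Nat
  open import Data.Fin using (Fin)
  open import Data.List using (_∷_; length; allFin)
  open import Data.Product using (Σ; _×_; _,_)
  open import Data.Integer using (+_)
  open import Relation.Binary.PropositionalEquality
  open import Relation.Nullary using (¬_)

  module _ {n} (A : Adj n) where

    costly-vertex : ∀ j → ¬ C A j ≡ + 0 → Σ (Fin n) λ x → Σ ℕ λ i → deg A x ≡ j × ¬ cN A x i ≡ 0
    costly-vertex j C≢0 =
      let (x , _ , term≢0) = ∑-nonzero (allFin n) _ (λ e → C≢0 (trans (C-as-classCost A j) (cong +_ (trans (classCost-as-∑ A j) e))))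
          (dx , cost≢0) = 𝟙-*-nonzero (deg A x ≡ᵇ j) (vertexCost A x) term≢0
          (i , _ , c≢0) = ∑-nonzero (range A) (cN A x) cost≢0
      in x , i , ≡ᵇ-true dx , c≢0

    class-size : ∀ {x j} → deg A x ≡ j → Σ ℕ λ k → length (V A j) ≡ suc k
    class-size {x} {j} dx with V A j | V-member A dx
    ... | _ ∷ xs | _ = length xs , refl

    unbalanced-pair : Symmetric A → Irreflexive A → ∀ j k i x → length (V A j) ≡ suc k → deg A x ≡ j → ¬ cN A x i ≡ 0 →
                      Σ (Fin n) λ v → Σ (Fin n) λ u →
                        deg A v ≡ j × deg A u ≡ j × Straddle (spectrumMass A j i) k (suc k * s A v i) (suc k * s A u i)
    unbalanced-pair symA irr j k i x len dx c≢0 =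
      let (v , u , Dv , Du , straddle) =
            straddling-pair (λ y → deg A y ≡ᵇ j) (λ y → s A y i) k (trans (sym (V-length A j)) len)
              x (subst (λ d → (d ≡ᵇ j) ≡ true) (sym dx) (≡ᵇ-refl j))
              (distQ-nonzero (spectrumMass A j i) k (suc k * s A x i) (λ e → c≢0 (trans (cost-formula A symA irr x i j k dx len) e)))
      in v , u , ≡ᵇ-true Dv , ≡ᵇ-true Du , straddle
      where open import Data.Bool using (true)

open import Defs
open import Data.Nat using (ℕ)
open import Data.Fin using (Fin)
open import Data.Integer using (_<_; +_)
open import Data.List.Membership.Propositional using (_∈_)
open import Data.Product using (_×_; ∃-syntax; _,_)
open import Relation.Nullary using (¬_)
open import Relation.Binary.PropositionalEquality using (_≡_)
open GraphBasics using (V-member)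
open Imbalance

lemma1 : ∀ {n : ℕ} (A : Adj n) → Symmetric A → Irreflexive A → NoIsolated A →
    (j : ℕ) → ¬ (C A j ≡ + 0) →
    ∃[ u ] ∃[ v ] ∃[ w ] ∃[ z ]
      (u ∈ V A j × v ∈ V A j × IsRSO A v u w z
       × C (swap A v u w z) j < C A j
       × ((ℓ : ℕ) → ¬ (ℓ ≡ j) → C (swap A v u w z) ℓ ≡ C A ℓ))
lemma1 A symA irr noIso j C≢0 =
  let (x , i , dx , cost≢0) = costly-vertex A j C≢0
      (k , len) = class-size A dx
      (v , u , dv , du , straddle) = unbalanced-pair A symA irr j k i x len dx cost≢0
      open Improvement.ImprovingSwap A symA irr noIso j k i len v u dv du straddle
  in u , v , w , z , V-member A du , V-member A dv , rso , C-decreases , C-others
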